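{- For any simple graph $G$ on $n$ vertices, $$|E(G)|-|E(G^{(2)})|\le \left\lfloor \frac n2\right\rfloor.$$ Furthermore, equality holds if and only if $G=K_{t_1,t_1}\cup K_{t_2,t_2}\cup\cdots\cup K_{t_k,t_k}\cup K_{\lfloor n/2\rfloor-\sum_{i=1}^k t_i,\ \lceil n/2\rceil-\sum_{i=1}^k t_i}$ (vertex-disjoint union) for some $k\ge 0$ and positive integers $t_1,\dots,t_k$ with $\sum_{i=1}^k t_i\le \lfloor n/2\rfloor$.
   Context: For a simple graph $G$, $G^{(2)}$ is the graph with vertex set $V(G)$ and edge set $\{\{u,v\}\colon u\ne v,\ \exists w\in V(G) \text{ with } \{u,w\},\{v,w\}\in E(G)\}$. Here $K_{a,b}$ denotes the complete bipartite graph with parts of sizes $a$ and $b$ ($K_{0,b}$ being $b$ isolated vertices). -}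

module Defs where

open import Data.Nat using (ℕ; zero; suc; _+_; _<ᵇ_; _≡ᵇ_)
open import Data.Bool using (Bool; true; false; _∧_; _xor_; not; if_then_else_)
open import Data.Fin using (Fin; toℕ; splitAt)
open import Data.List using (List; []; _∷_; allFin; map)
open import Data.Nat.ListAction using (sum)
open import Data.Bool.ListAction using (any)
open import Data.Sum using (_⊎_; inj₁; inj₂)
open import Data.Product using (_×_; _,_; Σ)
open import Relation.Binary.PropositionalEquality using (_≡_)
open import Function.Bundles using (_↔_; Inverse)

Rel : ℕ → Set
Rel n = Fin n → Fin n → Bool

record SimpleGraph (n : ℕ) : Set where
  field
    adj   : Rel n
    sym   : ∀ u v → adj u v ≡ adj v u
    irref : ∀ u → adj u u ≡ false
open SimpleGraph public

edges : ∀ {n} → Rel n → ℕ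
edges {n} R = sum (map (λ i → sum (map (λ j →
  if (toℕ i <ᵇ toℕ j) ∧ R i j then 1 else 0) (allFin n))) (allFin n))

square : ∀ {n} → Rel n → Rel n
square {n} R u v = not (toℕ u ≡ᵇ toℕ v) ∧ any (λ w → R u w ∧ R v w) (allFin n)

isLeft : ∀ {A B : Set} → A ⊎ B → Bool
isLeft (inj₁ _) = true
isLeft (inj₂ _) = false

K : (a b : ℕ) → Rel (a + b)
K a b u v = isLeft (splitAt a u) xor isLeft (splitAt a v)

_⊕_ : ∀ {m k} → Rel m → Rel k → Rel (m + k)
_⊕_ {m} R S u v with splitAt m u | splitAt m v
... | inj₁ x | inj₁ y = R x y
... | inj₂ x | inj₂ y = S x y
... | _      | _      = false

size : List (ℕ × ℕ) → ℕ
size [] = 0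
size ((a , b) ∷ ps) = (a + b) + size ps

unionK : (ps : List (ℕ × ℕ)) → Rel (size ps)
unionK [] = λ ()
unionK ((a , b) ∷ ps) = K a b ⊕ unionK ps

_≅_ : ∀ {n m} → Rel n → Rel m → Set
_≅_ {n} {m} R S = Σ (Fin n ↔ Fin m) λ σ →
  ∀ u v → R u v ≡ S (Inverse.to σ u) (Inverse.to σ v)

module Submission where

-- Count ordered pairs: arcs G = 2|E(G)|, so the bound reads arcs G ≤ arcs G² + 2⌊n/2⌋. It is proved
-- for the subgraphs induced on vertex sets S, with the square taken through common neighbours in S,
-- by deleting both ends of an edge uv: arcs drops by 2(deg u + deg v) − 2, the square by at least
-- 2(deg u + deg v) − 4 plus twice the number W of vertices joined to u in the square but not
-- adjacent to v. Equality therefore forces W = 0 for every edge, i.e. u ~² x and u ~ v imply v ~ x;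
-- then the component of any edge u₀v₀ is the complete bipartite graph on N(u₀) ∪ N(v₀). Splitting
-- off such a component K_{a,b} (a ≤ b) and comparing with the bound for the rest leaves only b = a,
-- or b = a + 1 with an even rest, which then contains no further unbalanced component. Conversely
-- K_{a,a}, K_{a,a+1} and K_{0,b} meet the bound with equality, with ⌊n/2⌋ the sum of the smaller sides.

open import Defs
open import Data.Nat using (ℕ; _+_; _∸_; _≤_; _<_)
open import Data.Nat.DivMod using (_/_)
open import Data.List using (List; _∷_; []; map; _++_)
open import Data.Nat.ListAction using (sum)
open import Data.List.Relation.Unary.All using (All)
open import Data.Product using (_×_; _,_; Σ)
open import Relation.Binary.PropositionalEquality using (_≡_)
open import Function.Bundles using (_⇔_)

open import Data.Nat using (zero; suc; _*_; z≤n; s≤s; _≡ᵇ_; _<ᵇ_; ⌊_/2⌋)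
open import Data.Nat.Properties
open import Data.Nat.DivMod using (m/n≡1+[m∸n]/n)
open import Data.Nat.Tactic.RingSolver using (solve-∀)
open import Data.Bool using (Bool; true; false; _∧_; _∨_; _xor_; not; if_then_else_)
open import Data.Bool.Properties using (T-≡; ∨-zeroʳ; ∧-zeroʳ; ∧-identityʳ; ∧-comm; xor-comm; xor-same; xor-annihilates-not)
open import Data.Bool.ListAction using (any)
open import Data.Fin using (Fin; zero; suc; toℕ; _↑ˡ_; _↑ʳ_; splitAt)
open import Data.Fin.Properties using (splitAt-↑ˡ; splitAt-↑ʳ; splitAt⁻¹-↑ˡ; splitAt⁻¹-↑ʳ; ↑ˡ-injective; ↑ʳ-injective; +↔⊎)
open import Data.List using (allFin; tabulate)
open import Data.List.Membership.Propositional using (lose; find)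
open import Data.List.Membership.Propositional.Properties using (∈-allFin)
open import Data.List.Relation.Unary.Any.Properties using (any⁺; any⁻)
open import Data.List.Relation.Unary.All using ([]; _∷_)
import Data.List.Relation.Unary.All as All
import Data.List.Relation.Unary.All.Properties as Allₚ
open import Data.Sum using (_⊎_; inj₁; inj₂)
import Data.Sum as Sum
open import Data.Sum.Algebra using (⊎-cong; ⊎-comm)
open import Data.Product using (∃; proj₁; proj₂; map₁; map₂)
open import Data.Empty using (⊥; ⊥-elim)
open import Relation.Nullary using (yes; no)
open import Data.Nat.Induction using (<-rec)
open import Function using (_∘_; id; _↔_; Inverse; mk↔ₛ′; mk⇔; Equivalence)
open import Function.Properties.Inverse using (↔-refl; ↔-sym; ↔-trans)
open import Relation.Binary.PropositionalEquality using (refl; cong; cong₂; trans; subst; subst₂; _≢_; module ≡-Reasoning)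
import Relation.Binary.PropositionalEquality as ≡
import Algebra.Properties.CommutativeMonoid.Sum as MonoidSum

module ℕ-Sum = MonoidSum +-0-commutativeMonoid

[_] : Bool → ℕ
[ b ] = if b then 1 else 0

not-both : ∀ {b} → b ≡ true → b ≡ false → ⊥
not-both refl ()

∧-true : ∀ {a b} → (a ∧ b) ≡ true → a ≡ true × b ≡ true
∧-true {true} {true} _ = refl , refl

∧-intro : ∀ {a b} → a ≡ true → b ≡ true → (a ∧ b) ≡ true
∧-intro refl refl = refl

not-true : ∀ {a} → not a ≡ true → a ≡ false
not-true {false} _ = refl

[]-pos : ∀ {b} → 0 < [ b ] → b ≡ true
[]-pos {true} _ = refl

[]-mono : ∀ {a b} → (a ≡ true → b ≡ true) → [ a ] ≤ [ b ]
[]-mono {false} _ = z≤n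
[]-mono {true}  f rewrite f refl = ≤-refl

bool-ext : ∀ {a b} → (a ≡ true → b ≡ true) → (b ≡ true → a ≡ true) → a ≡ b
bool-ext {false} {false} _ _ = refl
bool-ext {false} {true}  _ g = g refl
bool-ext {true}  {false} f _ = ≡.sym (f refl)
bool-ext {true}  {true}  _ _ = refl

_==_ : ∀ {n} → Fin n → Fin n → Bool
i == j = toℕ i ≡ᵇ toℕ j

==-refl : ∀ {n} (i : Fin n) → (i == i) ≡ true
==-refl zero    = refl
==-refl (suc i) = ==-refl i

==⇒≡ : ∀ {n} (i j : Fin n) → (i == j) ≡ true → i ≡ j
==⇒≡ zero    zero    _ = refl
==⇒≡ (suc i) (suc j) e = cong suc (==⇒≡ i j e)

==-sym : ∀ {n} (i j : Fin n) → (i == j) ≡ (j == i)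
==-sym zero    zero    = refl
==-sym zero    (suc j) = refl
==-sym (suc i) zero    = refl
==-sym (suc i) (suc j) = ==-sym i j

≢⇒==false : ∀ {n} (i j : Fin n) → i ≢ j → (i == j) ≡ false
≢⇒==false i j i≢j with i == j in e
... | true  = ⊥-elim (i≢j (==⇒≡ i j e))
... | false = refl

any-allFin⁺ : ∀ {n} (p : Fin n → Bool) (i : Fin n) → p i ≡ true → any p (allFin n) ≡ true
any-allFin⁺ p i e = Equivalence.to T-≡ (any⁺ p (lose (∈-allFin i) (Equivalence.from T-≡ e)))

any-allFin⁻ : ∀ {n} (p : Fin n → Bool) → any p (allFin n) ≡ true → ∃ λ i → p i ≡ true
any-allFin⁻ {n} p e with find (any⁻ p (allFin n) (Equivalence.from T-≡ e))
... | i , _ , pi = i , Equivalence.to T-≡ pi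

opaque
  ∑ : ∀ {n} → (Fin n → ℕ) → ℕ
  ∑ = ℕ-Sum.sum

opaque
  unfolding ∑

  ∑-cong : ∀ {n} {f g : Fin n → ℕ} → (∀ i → f i ≡ g i) → ∑ f ≡ ∑ g
  ∑-cong = ℕ-Sum.sum-cong-≗

  ∑-distrib-+ : ∀ {n} (f g : Fin n → ℕ) → ∑ (λ i → f i + g i) ≡ ∑ f + ∑ g
  ∑-distrib-+ = ℕ-Sum.∑-distrib-+

  ∑-comm : ∀ {n m} (f : Fin n → Fin m → ℕ) → ∑ (λ i → ∑ (f i)) ≡ ∑ (λ j → ∑ (λ i → f i j))
  ∑-comm = ℕ-Sum.∑-comm

  ∑-permute : ∀ {n m} (g : Fin m → ℕ) (σ : Fin n ↔ Fin m) → ∑ g ≡ ∑ (g ∘ Inverse.to σ)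
  ∑-permute = ℕ-Sum.∑-permute

  ∑-mono-≤ : ∀ {n} {f g : Fin n → ℕ} → (∀ i → f i ≤ g i) → ∑ f ≤ ∑ g
  ∑-mono-≤ {zero}  _ = z≤n
  ∑-mono-≤ {suc n} h = +-mono-≤ (h zero) (∑-mono-≤ (h ∘ suc))

  ∑-const : ∀ n c → ∑ {n} (λ _ → c) ≡ n * c
  ∑-const zero    c = refl
  ∑-const (suc n) c = cong (c +_) (∑-const n c)

  ∑-zero : ∀ {n} {f : Fin n → ℕ} → (∀ i → f i ≡ 0) → ∑ f ≡ 0
  ∑-zero {n} e = trans (∑-cong e) (trans (∑-const n 0) (*-zeroʳ n))

  ∑-count : ∀ n → ∑ {n} (λ _ → 1) ≡ n
  ∑-count n = trans (∑-const n 1) (*-identityʳ n)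

  ∑-↑ : ∀ m k (f : Fin (m + k) → ℕ) → ∑ f ≡ ∑ (λ i → f (i ↑ˡ k)) + ∑ (λ j → f (m ↑ʳ j))
  ∑-↑ zero    k f = refl
  ∑-↑ (suc m) k f = trans (cong (f zero +_) (∑-↑ m k (f ∘ suc))) (≡.sym (+-assoc (f zero) _ _))

  ∑-pos : ∀ {n} (f : Fin n → ℕ) → 0 < ∑ f → ∃ λ i → 0 < f i
  ∑-pos {suc n} f p with f zero in eq
  ... | suc _ = zero , subst (0 <_) (≡.sym eq) (s≤s z≤n)
  ... | zero with ∑-pos (f ∘ suc) p
  ...   | i , q = suc i , q

  ∑-single : ∀ {n} (u : Fin n) (g : Fin n → ℕ) → (∀ i → (i == u) ≡ false → g i ≡ 0) → ∑ g ≡ g u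
  ∑-single zero    g h = trans (cong (g zero +_) (∑-zero (λ i → h (suc i) refl))) (+-identityʳ _)
  ∑-single (suc u) g h = trans (cong (_+ ∑ (g ∘ suc)) (h zero refl)) (∑-single u (g ∘ suc) (h ∘ suc))

  term≤∑ : ∀ {n} (i : Fin n) (f : Fin n → ℕ) → f i ≤ ∑ f
  term≤∑ zero    f = m≤m+n _ _
  term≤∑ (suc i) f = ≤-trans (term≤∑ i (f ∘ suc)) (m≤n+m _ _)

  sum-map-allFin : ∀ {n} (f : Fin n → ℕ) → sum (map f (allFin n)) ≡ ∑ f
  sum-map-allFin f = go id
    where
    go : ∀ {m} (g : Fin m → Fin _) → sum (map f (tabulate g)) ≡ ∑ (f ∘ g)
    go {zero}  g = refl
    go {suc m} g = cong (f (g zero) +_) (go (g ∘ suc))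

Symmetric : ∀ {n} → Rel n → Set
Symmetric R = ∀ u v → R u v ≡ R v u

Irreflexive : ∀ {n} → Rel n → Set
Irreflexive R = ∀ u → R u u ≡ false

VertexSet : ℕ → Set
VertexSet n = Fin n → Bool

everything : ∀ {n} → VertexSet n
everything _ = true

squareWithin : ∀ {n} → Rel n → VertexSet n → Rel n
squareWithin {n} R S u v = not (u == v) ∧ any (λ w → S w ∧ (R u w ∧ R v w)) (allFin n)

module _ {n} (R : Rel n) where

  squareWithin-intro : ∀ S u v w → (u == v) ≡ false → S w ≡ true → R u w ≡ true → R v w ≡ true →
                       squareWithin R S u v ≡ true
  squareWithin-intro S u v w u≠v sw uw vw rewrite u≠v = any-allFin⁺ _ w (∧-intro sw (∧-intro uw vw))

  squareWithin-elim : ∀ S u v → squareWithin R S u v ≡ true →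
                      (u == v) ≡ false × ∃ λ w → S w ≡ true × R u w ≡ true × R v w ≡ true
  squareWithin-elim S u v e with ∧-true {not (u == v)} e
  ... | u≠v , ∃w with any-allFin⁻ _ ∃w
  ...   | w , q with ∧-true q
  ...     | sw , q′ with ∧-true q′
  ...       | uw , vw = not-true u≠v , w , sw , uw , vw

  squareWithin-sym : ∀ S → Symmetric (squareWithin R S)
  squareWithin-sym S u v = bool-ext (flip u v) (flip v u)
    where
    flip : ∀ u v → squareWithin R S u v ≡ true → squareWithin R S v u ≡ true
    flip u v e with squareWithin-elim S u v e
    ... | u≠v , w , sw , uw , vw = squareWithin-intro S v u w (trans (==-sym v u) u≠v) sw vw uw

  squareWithin-irrefl : ∀ S → Irreflexive (squareWithin R S)
  squareWithin-irrefl S u rewrite ==-refl u = refl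

  squareWithin-mono : ∀ {S T} → (∀ w → T w ≡ true → S w ≡ true) →
                      ∀ u v → squareWithin R T u v ≡ true → squareWithin R S u v ≡ true
  squareWithin-mono {S} {T} T⊆S u v e with squareWithin-elim T u v e
  ... | u≠v , w , tw , uw , vw = squareWithin-intro S u v w u≠v (T⊆S w tw) uw vw

  square-intro : ∀ u v w → (u == v) ≡ false → R u w ≡ true → R v w ≡ true → square R u v ≡ true
  square-intro u v w u≠v = squareWithin-intro everything u v w u≠v refl

  square-sym : Symmetric (square R)
  square-sym = squareWithin-sym everything

  square-irrefl : Irreflexive (square R)
  square-irrefl = squareWithin-irrefl everything

arcs : ∀ {n} → Rel n → ℕ
arcs R = ∑ (λ i → ∑ (λ j → [ R i j ]))

arcs-cong : ∀ {n} {R S : Rel n} → (∀ u v → R u v ≡ S u v) → arcs R ≡ arcs S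
arcs-cong e = ∑-cong (λ i → ∑-cong (λ j → cong [_] (e i j)))

private
  _≺_ : ∀ {n} → Fin n → Fin n → Bool
  i ≺ j = toℕ i <ᵇ toℕ j

  ≺-trichotomy : ∀ {n} (i j : Fin n) → (i ≺ j) ≡ false → (j ≺ i) ≡ false → i ≡ j
  ≺-trichotomy zero    zero    _ _ = refl
  ≺-trichotomy (suc i) (suc j) p q = cong suc (≺-trichotomy i j p q)

  ≺-asym : ∀ {n} (i j : Fin n) → (i ≺ j) ≡ true → (j ≺ i) ≡ true → ⊥
  ≺-asym (suc i) (suc j) = ≺-asym i j

module _ {n} (R : Rel n) (R-sym : Symmetric R) (R-irrefl : Irreflexive R) where

  private
    upper : ℕ
    upper = ∑ (λ i → ∑ (λ j → [ (i ≺ j) ∧ R i j ]))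

    split-by-order : ∀ i j → [ R i j ] ≡ [ (i ≺ j) ∧ R i j ] + [ (j ≺ i) ∧ R i j ]
    split-by-order i j with i ≺ j in p | j ≺ i in q
    ... | true  | true  = ⊥-elim (≺-asym i j p q)
    ... | true  | false = ≡.sym (+-identityʳ _)
    ... | false | true  = refl
    ... | false | false rewrite ≺-trichotomy i j p q | R-irrefl j = refl

    lower≡upper : ∑ (λ i → ∑ (λ j → [ (j ≺ i) ∧ R i j ])) ≡ upper
    lower≡upper = trans (∑-comm (λ i j → [ (j ≺ i) ∧ R i j ]))
                        (∑-cong λ j → ∑-cong λ i → cong (λ b → [ (j ≺ i) ∧ b ]) (R-sym i j))

  arcs≡2*edges : arcs R ≡ 2 * edges R
  arcs≡2*edges = begin
    arcs R                                                      ≡⟨ ∑-cong (λ i → trans (∑-cong (split-by-order i)) (∑-distrib-+ _ _)) ⟩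
    ∑ (λ i → ∑ (λ j → [ (i ≺ j) ∧ R i j ]) + ∑ (λ j → [ (j ≺ i) ∧ R i j ])) ≡⟨ ∑-distrib-+ _ _ ⟩
    upper + ∑ (λ i → ∑ (λ j → [ (j ≺ i) ∧ R i j ]))           ≡⟨ cong (upper +_) lower≡upper ⟩
    upper + upper                                               ≡⟨ cong (upper +_) (≡.sym (+-identityʳ upper)) ⟩
    2 * upper                                                   ≡⟨ cong (2 *_) edges≡upper ⟨
    2 * edges R                                                 ∎
    where
    open ≡-Reasoning
    edges≡upper : edges R ≡ upper
    edges≡upper = trans (sum-map-allFin _) (∑-cong (λ i → sum-map-allFin _))

∑-remove : ∀ {n} (T : VertexSet n) (x : Fin n) → ∑ (λ j → [ T j ]) ≡ ∑ (λ j → [ T j ∧ not (j == x) ]) + [ T x ]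
∑-remove T x = begin
  ∑ (λ j → [ T j ])                                                  ≡⟨ ∑-cong (λ j → split (T j) (j == x)) ⟩
  ∑ (λ j → [ T j ∧ not (j == x) ] + [ T j ∧ (j == x) ])             ≡⟨ ∑-distrib-+ _ _ ⟩
  ∑ (λ j → [ T j ∧ not (j == x) ]) + ∑ (λ j → [ T j ∧ (j == x) ])   ≡⟨ cong (∑ (λ j → [ T j ∧ not (j == x) ]) +_) only-x ⟩
  ∑ (λ j → [ T j ∧ not (j == x) ]) + [ T x ]                          ∎
  where
  open ≡-Reasoning
  split : ∀ t c → [ t ] ≡ [ t ∧ not c ] + [ t ∧ c ]
  split false c     = refl
  split true  false = refl
  split true  true  = refl
  only-x : ∑ (λ j → [ T j ∧ (j == x) ]) ≡ [ T x ]
  only-x = trans (∑-single x _ (λ j j≠x → trans (cong (λ b → [ T j ∧ b ]) j≠x) (cong [_] (∧-zeroʳ (T j)))))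
                 (trans (cong (λ b → [ T x ∧ b ]) (==-refl x)) (cong [_] (∧-identityʳ (T x))))

-- The inequality

-- E S and F S are twice the numbers of edges of R[S] and of its square through S.
module Counting {n} (R : Rel n) (R-sym : Symmetric R) (R-irrefl : Irreflexive R) where

  card : VertexSet n → ℕ
  card S = ∑ (λ i → [ S i ])

  arcsWithin : VertexSet n → Rel n → ℕ
  arcsWithin S X = ∑ (λ i → ∑ (λ j → [ S i ∧ (S j ∧ X i j) ]))

  E F : VertexSet n → ℕ
  E S = arcsWithin S R
  F S = arcsWithin S (squareWithin R S)

  deg : VertexSet n → Fin n → ℕ
  deg S w = ∑ (λ j → [ S j ∧ R w j ])

  _-_ : VertexSet n → Fin n → VertexSet n
  (S - u) x = S x ∧ not (x == u)

  ∈-remove : ∀ S u x → (S - u) x ≡ true → S x ≡ true × (x == u) ≡ false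
  ∈-remove S u x e with ∧-true {S x} e
  ... | sx , x≠u = sx , not-true x≠u

  card-remove : ∀ S x → S x ≡ true → card S ≡ card (S - x) + 1
  card-remove S x sx = trans (∑-remove S x) (cong (λ b → card (S - x) + [ b ]) sx)

  deg-remove : ∀ S x w → deg S w ≡ deg (S - x) w + [ S x ∧ R w x ]
  deg-remove S x w = trans (∑-remove (λ j → S j ∧ R w j) x)
    (cong (_+ _) (∑-cong (λ j → cong [_] (∧-swapʳ (S j) (R w j) (not (j == x))))))
    where
    ∧-swapʳ : ∀ a b c → ((a ∧ b) ∧ c) ≡ ((a ∧ c) ∧ b)
    ∧-swapʳ false b c = refl
    ∧-swapʳ true  b c = ∧-comm b c

  -- A pair (i , j) in S × S either avoids u, or has i = u, or has j = u ≠ i.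
  arcsWithin-remove : ∀ S X u → S u ≡ true →
    arcsWithin S X ≡ arcsWithin (S - u) X + ∑ (λ j → [ S j ∧ X u j ]) + ∑ (λ i → [ (S - u) i ∧ X i u ])
  arcsWithin-remove S X u su = begin
    arcsWithin S X
      ≡⟨ ∑-cong (λ i → trans (∑-cong (λ j → trichotomy (S i) (S j) (i == u) (j == u) (X i j) (in-S i) (in-S j)))
                             (distrib₃ _ _ _)) ⟩
    ∑ (λ i → ∑ (λ j → [ (S - u) i ∧ ((S - u) j ∧ X i j) ]) + ∑ (λ j → [ (i == u) ∧ (S j ∧ X i j) ])
             + ∑ (λ j → [ (S - u) i ∧ ((j == u) ∧ X i j) ]))
      ≡⟨ distrib₃ _ _ _ ⟩
    arcsWithin (S - u) X + ∑ (λ i → ∑ (λ j → [ (i == u) ∧ (S j ∧ X i j) ]))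
                         + ∑ (λ i → ∑ (λ j → [ (S - u) i ∧ ((j == u) ∧ X i j) ]))
      ≡⟨ cong₂ (λ a b → arcsWithin (S - u) X + a + b) row-u column-u ⟩
    arcsWithin (S - u) X + ∑ (λ j → [ S j ∧ X u j ]) + ∑ (λ i → [ (S - u) i ∧ X i u ]) ∎
    where
    open ≡-Reasoning
    in-S : ∀ i → (i == u) ≡ true → S i ≡ true
    in-S i i=u rewrite ==⇒≡ i u i=u = su
    trichotomy : ∀ si sj iu ju x → (iu ≡ true → si ≡ true) → (ju ≡ true → sj ≡ true) →
      [ si ∧ (sj ∧ x) ] ≡ [ (si ∧ not iu) ∧ ((sj ∧ not ju) ∧ x) ] + [ iu ∧ (sj ∧ x) ] + [ (si ∧ not iu) ∧ (ju ∧ x) ]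
    trichotomy si sj true  ju    x h _ rewrite h refl = ≡.sym (+-identityʳ _)
    trichotomy si sj false true  x _ h rewrite h refl | ∧-identityʳ si | ∧-zeroʳ si = refl
    trichotomy si sj false false x _ _ rewrite ∧-identityʳ si | ∧-identityʳ sj | ∧-zeroʳ si =
      ≡.sym (trans (+-identityʳ _) (+-identityʳ _))
    distrib₃ : ∀ (a b c : Fin n → ℕ) → ∑ (λ i → a i + b i + c i) ≡ ∑ a + ∑ b + ∑ c
    distrib₃ a b c = trans (∑-distrib-+ (λ i → a i + b i) c) (cong (_+ ∑ c) (∑-distrib-+ a b))
    row-u : ∑ (λ i → ∑ (λ j → [ (i == u) ∧ (S j ∧ X i j) ])) ≡ ∑ (λ j → [ S j ∧ X u j ])
    row-u = trans (∑-single u _ (λ i i≠u → ∑-zero (λ j → cong (λ b → [ b ∧ (S j ∧ X i j) ]) i≠u)))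
                  (∑-cong (λ j → cong (λ b → [ b ∧ (S j ∧ X u j) ]) (==-refl u)))
    column-u : ∑ (λ i → ∑ (λ j → [ (S - u) i ∧ ((j == u) ∧ X i j) ])) ≡ ∑ (λ i → [ (S - u) i ∧ X i u ])
    column-u = ∑-cong λ i →
      trans (∑-single u _ (λ j j≠u → trans (cong (λ b → [ (S - u) i ∧ (b ∧ X i j) ]) j≠u) (cong [_] (∧-zeroʳ _))))
            (cong (λ b → [ (S - u) i ∧ (b ∧ X i u) ]) (==-refl u))

  E-remove : ∀ S u → S u ≡ true → E S ≡ E (S - u) + 2 * deg S u
  E-remove S u su = begin
    E S                                                         ≡⟨ arcsWithin-remove S R u su ⟩
    E (S - u) + deg S u + ∑ (λ i → [ (S - u) i ∧ R i u ])      ≡⟨ cong (E (S - u) + deg S u +_) column≡deg ⟩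
    E (S - u) + deg S u + deg S u                               ≡⟨ regroup (E (S - u)) (deg S u) ⟩
    E (S - u) + 2 * deg S u                                     ∎
    where
    open ≡-Reasoning
    regroup : ∀ e d → e + d + d ≡ e + 2 * d
    regroup = solve-∀
    column≡deg : ∑ (λ i → [ (S - u) i ∧ R i u ]) ≡ deg S u
    column≡deg = ∑-cong pointwise
      where
      pointwise : ∀ i → [ (S - u) i ∧ R i u ] ≡ [ S i ∧ R u i ]
      pointwise i rewrite R-sym i u with i == u in i=u
      ... | false = cong (λ b → [ b ∧ R u i ]) (∧-identityʳ (S i))
      ... | true rewrite ==⇒≡ i u i=u | R-irrefl u = cong [_] (trans (∧-zeroʳ _) (≡.sym (∧-zeroʳ (S u))))

  module RemoveEdge (S : VertexSet n) (u v : Fin n) (su : S u ≡ true) (sv : S v ≡ true) (uv : R u v ≡ true) where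

    S′ S″ : VertexSet n
    S′ = S - u
    S″ = S′ - v

    X : Rel n
    X = squareWithin R S

    u≠v : (u == v) ≡ false
    u≠v = ≢⇒==false u v λ u≡v → not-both uv (trans (cong (R u) (≡.sym u≡v)) (R-irrefl u))

    s′v : S′ v ≡ true
    s′v rewrite sv | ==-sym v u | u≠v = refl

    S″⊆S : ∀ w → S″ w ≡ true → S w ≡ true
    S″⊆S w s″w = proj₁ (∈-remove S u w (proj₁ (∈-remove S′ v w s″w)))

    du dv W : ℕ
    du = deg S″ u
    dv = deg S′ v
    W = ∑ (λ j → [ S′ j ∧ (X u j ∧ not (R v j)) ])

    deg-u : deg S u ≡ suc du
    deg-u = begin
      deg S u                                    ≡⟨ deg-remove S u u ⟩
      deg S′ u + [ S u ∧ R u u ]                 ≡⟨ cong (λ b → deg S′ u + [ b ]) (trans (cong (S u ∧_) (R-irrefl u)) (∧-zeroʳ (S u))) ⟩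
      deg S′ u + 0                               ≡⟨ +-identityʳ _ ⟩
      deg S′ u                                   ≡⟨ deg-remove S′ v u ⟩
      du + [ S′ v ∧ R u v ]                      ≡⟨ cong (λ b → du + [ b ]) (trans (cong (_∧ R u v) s′v) uv) ⟩
      du + 1                                     ≡⟨ +-comm du 1 ⟩
      suc du                                     ∎
      where open ≡-Reasoning

    E-removeEdge : E S ≡ E S″ + 2 * dv + 2 * suc du
    E-removeEdge = trans (E-remove S u su) (cong₂ (λ e d → e + 2 * d) (E-remove S′ v s′v) deg-u)

    card-removeEdge : card S ≡ 2 + card S″
    card-removeEdge = trans (card-remove S u su) (trans (cong (_+ 1) (card-remove S′ v s′v)) (trans (+-assoc (card S″) 1 1) (+-comm (card S″) 2)))

    v-adj⇒X-u : ∀ j → S′ j ≡ true → R v j ≡ true → X u j ≡ true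
    v-adj⇒X-u j s′j vj =
      squareWithin-intro R S u j v (trans (==-sym u j) (proj₂ (∈-remove S u j s′j))) sv uv (trans (R-sym j v) vj)

    u-adj⇒X-v : ∀ j → S″ j ≡ true → R u j ≡ true → X v j ≡ true
    u-adj⇒X-v j s″j uj =
      squareWithin-intro R S v j u (trans (==-sym v j) (proj₂ (∈-remove S′ v j s″j))) su (trans (R-sym v u) uv) (trans (R-sym j u) uj)

    private
      split-≤ : ∀ s r x → ((s ∧ r) ≡ true → x ≡ true) → [ s ∧ r ] + [ s ∧ (x ∧ not r) ] ≤ [ s ∧ x ]
      split-≤ false r     x _ = z≤n
      split-≤ true  true  x h rewrite h refl = ≤-refl
      split-≤ true  false x _ rewrite ∧-identityʳ x = ≤-refl

    through-v : dv + W ≤ ∑ (λ j → [ S′ j ∧ X u j ])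
    through-v = ≤-trans (≤-reflexive (≡.sym (∑-distrib-+ _ _)))
      (∑-mono-≤ λ j → split-≤ (S′ j) (R v j) (X u j) λ h → let (s′j , vj) = ∧-true h in v-adj⇒X-u j s′j vj)

    row-u : dv + W ≤ ∑ (λ j → [ S j ∧ X u j ])
    row-u = ≤-trans through-v (∑-mono-≤ λ j → []-mono λ h →
      let (s′j , xj) = ∧-true h in ∧-intro (proj₁ (∈-remove S u j s′j)) xj)

    column-u : dv + W ≤ ∑ (λ i → [ S′ i ∧ X i u ])
    column-u = subst (dv + W ≤_) (∑-cong λ i → cong (λ b → [ S′ i ∧ b ]) (squareWithin-sym R S u i)) through-v

    row-v : du ≤ ∑ (λ j → [ S′ j ∧ X v j ])
    row-v = ∑-mono-≤ λ j → []-mono λ h →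
      let (s″j , uj) = ∧-true h in ∧-intro (proj₁ (∈-remove S′ v j s″j)) (u-adj⇒X-v j s″j uj)

    column-v : du ≤ ∑ (λ i → [ S″ i ∧ X i v ])
    column-v = ∑-mono-≤ λ i → []-mono λ h →
      let (s″i , ui) = ∧-true h in ∧-intro s″i (trans (squareWithin-sym R S i v) (u-adj⇒X-v i s″i ui))

    F-mono : F S″ ≤ arcsWithin S″ X
    F-mono = ∑-mono-≤ λ i → ∑-mono-≤ λ j → []-mono {S″ i ∧ (S″ j ∧ squareWithin R S″ i j)} λ h →
      let (s″i , h′) = ∧-true {S″ i} h ; (s″j , x″) = ∧-true {S″ j} h′
      in ∧-intro s″i (∧-intro s″j (squareWithin-mono R S″⊆S i j x″))

    F-removeEdge : F S″ + 2 * du + 2 * (dv + W) ≤ F S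
    F-removeEdge = begin
      F S″ + 2 * du + 2 * (dv + W)                       ≡⟨ regroup (F S″) du (dv + W) ⟩
      F S″ + du + du + (dv + W) + (dv + W)               ≤⟨ +-mono-≤ (+-mono-≤ (+-mono-≤ (+-mono-≤ F-mono row-v) column-v) row-u) column-u ⟩
      arcsWithin S″ X + ∑ (λ j → [ S′ j ∧ X v j ]) + ∑ (λ i → [ S″ i ∧ X i v ])
        + ∑ (λ j → [ S j ∧ X u j ]) + ∑ (λ i → [ S′ i ∧ X i u ])
                                                          ≡⟨ cong (λ a → a + ∑ (λ j → [ S j ∧ X u j ]) + ∑ (λ i → [ S′ i ∧ X i u ]))
                                                                  (arcsWithin-remove S′ X v s′v) ⟨
      arcsWithin S′ X + ∑ (λ j → [ S j ∧ X u j ]) + ∑ (λ i → [ S′ i ∧ X i u ])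
                                                          ≡⟨ arcsWithin-remove S X u su ⟨
      F S                                                 ∎
      where
      open ≤-Reasoning
      regroup : ∀ f a b → f + 2 * a + 2 * b ≡ f + a + a + b + b
      regroup = solve-∀

    removeEdge-step : E S″ ≤ F S″ + 2 * ⌊ card S″ /2⌋ → E S + 2 * W ≤ F S + 2 * ⌊ card S /2⌋
    removeEdge-step ih rewrite card-removeEdge = begin
      E S + 2 * W                                               ≡⟨ cong (_+ 2 * W) E-removeEdge ⟩
      E S″ + 2 * dv + 2 * suc du + 2 * W                        ≤⟨ +-monoˡ-≤ (2 * W) (+-monoˡ-≤ (2 * suc du) (+-monoˡ-≤ (2 * dv) ih)) ⟩
      F S″ + 2 * h + 2 * dv + 2 * suc du + 2 * W                ≡⟨ regroup (F S″) h dv du W ⟩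
      F S″ + 2 * du + 2 * (dv + W) + 2 * suc h                  ≤⟨ +-monoˡ-≤ (2 * suc h) F-removeEdge ⟩
      F S + 2 * suc h                                           ∎
      where
      open ≤-Reasoning
      h = ⌊ card S″ /2⌋
      regroup : ∀ f h dv du w → f + 2 * h + 2 * dv + 2 * suc du + 2 * w ≡ f + 2 * du + 2 * (dv + w) + 2 * suc h
      regroup = solve-∀

  an-edge : ∀ S → 0 < E S → ∃ λ u → ∃ λ v → S u ≡ true × S v ≡ true × R u v ≡ true
  an-edge S E>0 with ∑-pos _ E>0
  ... | u , row>0 with ∑-pos _ row>0
  ...   | v , uv>0 with ∧-true ([]-pos uv>0)
  ...     | su , h with ∧-true h
  ...       | sv , uv = u , v , su , sv , uv

  arcsWithin-bound : ∀ S → E S ≤ F S + 2 * ⌊ card S /2⌋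
  arcsWithin-bound S = <-rec P bound (card S) S refl
    where
    P : ℕ → Set
    P k = ∀ S → card S ≡ k → E S ≤ F S + 2 * ⌊ card S /2⌋
    bound : ∀ k → (∀ {m} → m < k → P m) → P k
    bound _ ih S refl with 0 <? E S
    ... | no  E≯0 = ≤-trans (≮⇒≥ E≯0) z≤n
    ... | yes E>0 with an-edge S E>0
    ...   | u , v , su , sv , uv = ≤-trans (m≤m+n (E S) _) (removeEdge-step (ih smaller S″ refl))
      where
      open RemoveEdge S u v su sv uv
      smaller : card S″ < card S
      smaller = subst (card S″ <_) (≡.sym card-removeEdge) (s≤s (n≤1+n _))

  arcs-bound : arcs R ≤ arcs (square R) + 2 * ⌊ n /2⌋
  arcs-bound = subst (λ c → arcs R ≤ arcs (square R) + 2 * ⌊ c /2⌋) (∑-count n) (arcsWithin-bound everything)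

  extremal⇒square-closed : arcs R ≡ arcs (square R) + 2 * ⌊ n /2⌋ →
                           ∀ u v x → R u v ≡ true → square R u x ≡ true → R v x ≡ true
  extremal⇒square-closed extremal u v x uv ux = v-adj-x
    where
    open RemoveEdge everything u v refl refl uv
    no-W : W ≡ 0
    no-W = *-cancelˡ-≡ W 0 2 (n≤0⇒n≡0 (+-cancelˡ-≤ (arcs R) (2 * W) 0 (begin
      arcs R + 2 * W                                  ≤⟨ removeEdge-step (arcsWithin-bound S″) ⟩
      arcs (square R) + 2 * ⌊ card everything /2⌋     ≡⟨ cong (λ c → arcs (square R) + 2 * ⌊ c /2⌋) (∑-count n) ⟩
      arcs (square R) + 2 * ⌊ n /2⌋                   ≡⟨ extremal ⟨
      arcs R                                          ≡⟨ +-identityʳ _ ⟨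
      arcs R + 0                                      ∎)))
      where open ≤-Reasoning
    x≠u : (x == u) ≡ false
    x≠u = trans (==-sym x u) (proj₁ (squareWithin-elim R everything u x ux))
    X-ux : X u x ≡ true
    X-ux = ux
    summand-x : R v x ≡ false → [ S′ x ∧ (X u x ∧ not (R v x)) ] ≡ 1
    summand-x vx rewrite vx | x≠u | X-ux = refl
    v-adj-x : R v x ≡ true
    v-adj-x with R v x in vx
    ... | true  = refl
    ... | false = ⊥-elim (1≢0 (trans (≡.sym (summand-x vx)) (n≤0⇒n≡0 (≤-trans (term≤∑ x _) (≤-reflexive no-W)))))
      where
      1≢0 : 1 ≢ 0
      1≢0 ()

-- Isomorphism and disjoint union

-- Isomorphism of Boolean relations on arbitrary carriers; between vertex sets Fin n it is _≅_,
-- repackaged as a record so that the relations can be inferred.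
record _≃_ {A B : Set} (R : A → A → Bool) (S : B → B → Bool) : Set where
  constructor mk≃
  field
    bijection   : A ↔ B
    homomorphic : ∀ x y → R x y ≡ S (Inverse.to bijection x) (Inverse.to bijection y)

≅⇒≃ : ∀ {n m} {R : Rel n} {S : Rel m} → R ≅ S → R ≃ S
≅⇒≃ (σ , hom) = mk≃ σ hom

≃⇒≅ : ∀ {n m} {R : Rel n} {S : Rel m} → R ≃ S → R ≅ S
≃⇒≅ (mk≃ σ hom) = σ , hom

≃-pointwise : ∀ {A : Set} {R R′ : A → A → Bool} → (∀ x y → R x y ≡ R′ x y) → R ≃ R′
≃-pointwise R≗R′ = mk≃ ↔-refl R≗R′

≃-sym : ∀ {A B : Set} {R : A → A → Bool} {S : B → B → Bool} → R ≃ S → S ≃ R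
≃-sym {S = S} (mk≃ σ hom) = mk≃ (↔-sym σ) λ x y →
  trans (cong₂ S (≡.sym (Inverse.strictlyInverseˡ σ x)) (≡.sym (Inverse.strictlyInverseˡ σ y))) (≡.sym (hom _ _))

≃-trans : ∀ {A B C : Set} {R : A → A → Bool} {S : B → B → Bool} {T : C → C → Bool} → R ≃ S → S ≃ T → R ≃ T
≃-trans (mk≃ σ hom) (mk≃ τ hom′) = mk≃ (↔-trans σ τ) λ x y → trans (hom x y) (hom′ _ _)

≃-refl : ∀ {A : Set} (R : A → A → Bool) → R ≃ R
≃-refl R = ≃-pointwise λ _ _ → refl

≃-empty : (R S : Rel 0) → R ≃ S
≃-empty R S = ≃-pointwise λ ()

_⊎ᴿ_ : ∀ {A B : Set} → (A → A → Bool) → (B → B → Bool) → (A ⊎ B → A ⊎ B → Bool)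
(R ⊎ᴿ S) (inj₁ x) (inj₁ y) = R x y
(R ⊎ᴿ S) (inj₂ x) (inj₂ y) = S x y
(R ⊎ᴿ S) _        _        = false

⊕-view : ∀ {m k} (R : Rel m) (S : Rel k) u v → (R ⊕ S) u v ≡ (R ⊎ᴿ S) (splitAt m u) (splitAt m v)
⊕-view {m} R S u v with splitAt m u | splitAt m v
... | inj₁ _ | inj₁ _ = refl
... | inj₁ _ | inj₂ _ = refl
... | inj₂ _ | inj₁ _ = refl
... | inj₂ _ | inj₂ _ = refl

⊕≃⊎ᴿ : ∀ {m k} (R : Rel m) (S : Rel k) → (R ⊕ S) ≃ (R ⊎ᴿ S)
⊕≃⊎ᴿ {m} {k} R S = mk≃ (+↔⊎ {m} {k}) (⊕-view R S)

⊎ᴿ-cong : ∀ {A A′ B B′ : Set} {R : A → A → Bool} {R′ : A′ → A′ → Bool} {S : B → B → Bool} {S′ : B′ → B′ → Bool} →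
          R ≃ R′ → S ≃ S′ → (R ⊎ᴿ S) ≃ (R′ ⊎ᴿ S′)
⊎ᴿ-cong (mk≃ σ hom) (mk≃ τ hom′) = mk≃ (⊎-cong σ τ) λ
  { (inj₁ x) (inj₁ y) → hom x y
  ; (inj₁ x) (inj₂ y) → refl
  ; (inj₂ x) (inj₁ y) → refl
  ; (inj₂ x) (inj₂ y) → hom′ x y }

⊎ᴿ-swap : ∀ {A B C : Set} (R : A → A → Bool) (S : B → B → Bool) (T : C → C → Bool) →
          (R ⊎ᴿ (S ⊎ᴿ T)) ≃ (S ⊎ᴿ (R ⊎ᴿ T))
⊎ᴿ-swap {C = C} R S T = mk≃ (mk↔ₛ′ swap swap swap-involutive swap-involutive) hom
  where
  swap : ∀ {A B} → A ⊎ (B ⊎ C) → B ⊎ (A ⊎ C)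
  swap (inj₁ x)        = inj₂ (inj₁ x)
  swap (inj₂ (inj₁ y)) = inj₁ y
  swap (inj₂ (inj₂ z)) = inj₂ (inj₂ z)
  swap-involutive : ∀ {A B} (p : A ⊎ (B ⊎ C)) → swap (swap p) ≡ p
  swap-involutive (inj₁ _)        = refl
  swap-involutive (inj₂ (inj₁ _)) = refl
  swap-involutive (inj₂ (inj₂ _)) = refl
  hom : ∀ p q → (R ⊎ᴿ (S ⊎ᴿ T)) p q ≡ (S ⊎ᴿ (R ⊎ᴿ T)) (swap p) (swap q)
  hom (inj₁ _)        (inj₁ _)        = refl
  hom (inj₁ _)        (inj₂ (inj₁ _)) = refl
  hom (inj₁ _)        (inj₂ (inj₂ _)) = refl
  hom (inj₂ (inj₁ _)) (inj₁ _)        = refl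
  hom (inj₂ (inj₁ _)) (inj₂ (inj₁ _)) = refl
  hom (inj₂ (inj₁ _)) (inj₂ (inj₂ _)) = refl
  hom (inj₂ (inj₂ _)) (inj₁ _)        = refl
  hom (inj₂ (inj₂ _)) (inj₂ (inj₁ _)) = refl
  hom (inj₂ (inj₂ _)) (inj₂ (inj₂ _)) = refl

⊕-cong : ∀ {m m′ k k′} {R : Rel m} {R′ : Rel m′} {S : Rel k} {S′ : Rel k′} → R ≃ R′ → S ≃ S′ → (R ⊕ S) ≃ (R′ ⊕ S′)
⊕-cong {R = R} {R′} {S} {S′} R≅R′ S≅S′ =
  ≃-trans (⊕≃⊎ᴿ R S) (≃-trans (⊎ᴿ-cong R≅R′ S≅S′) (≃-sym (⊕≃⊎ᴿ R′ S′)))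

⊕-congˡ : ∀ {m k k′} (R : Rel m) {S : Rel k} {S′ : Rel k′} → S ≃ S′ → (R ⊕ S) ≃ (R ⊕ S′)
⊕-congˡ R = ⊕-cong (≃-refl R)

⊕-swap : ∀ {a b c} (R : Rel a) (S : Rel b) (T : Rel c) → (R ⊕ (S ⊕ T)) ≃ (S ⊕ (R ⊕ T))
⊕-swap R S T =
  ≃-trans (⊕≃⊎ᴿ R (S ⊕ T)) (≃-trans (⊎ᴿ-cong (≃-refl R) (⊕≃⊎ᴿ S T)) (≃-trans (⊎ᴿ-swap R S T)
    (≃-trans (⊎ᴿ-cong (≃-refl S) (≃-sym (⊕≃⊎ᴿ R T))) (≃-sym (⊕≃⊎ᴿ S (R ⊕ T))))))

⊕-sym : ∀ {m k} {R : Rel m} {S : Rel k} → Symmetric R → Symmetric S → Symmetric (R ⊕ S)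
⊕-sym {m} {R = R} {S} R-sym S-sym u v =
  trans (⊕-view R S u v) (trans (sym-⊎ᴿ (splitAt m u) (splitAt m v)) (≡.sym (⊕-view R S v u)))
  where
  sym-⊎ᴿ : ∀ p q → (R ⊎ᴿ S) p q ≡ (R ⊎ᴿ S) q p
  sym-⊎ᴿ (inj₁ x) (inj₁ y) = R-sym x y
  sym-⊎ᴿ (inj₁ _) (inj₂ _) = refl
  sym-⊎ᴿ (inj₂ _) (inj₁ _) = refl
  sym-⊎ᴿ (inj₂ x) (inj₂ y) = S-sym x y

⊕-irrefl : ∀ {m k} {R : Rel m} {S : Rel k} → Irreflexive R → Irreflexive S → Irreflexive (R ⊕ S)
⊕-irrefl {m} {R = R} {S} R-irrefl S-irrefl u = trans (⊕-view R S u u) (irrefl-⊎ᴿ (splitAt m u))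
  where
  irrefl-⊎ᴿ : ∀ p → (R ⊎ᴿ S) p p ≡ false
  irrefl-⊎ᴿ (inj₁ x) = R-irrefl x
  irrefl-⊎ᴿ (inj₂ x) = S-irrefl x

_⊕ᴳ_ : ∀ {m k} → SimpleGraph m → SimpleGraph k → SimpleGraph (m + k)
G ⊕ᴳ H = record
  { adj   = adj G ⊕ adj H
  ; sym   = ⊕-sym (SimpleGraph.sym G) (SimpleGraph.sym H)
  ; irref = ⊕-irrefl (irref G) (irref H) }

Kᴳ : ∀ a b → SimpleGraph (a + b)
Kᴳ a b = record
  { adj   = K a b
  ; sym   = λ u v → xor-comm (isLeft (splitAt a u)) (isLeft (splitAt a v))
  ; irref = λ u → xor-same (isLeft (splitAt a u)) }

data Side (m k : ℕ) : Fin (m + k) → Set where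
  left  : ∀ i → Side m k (i ↑ˡ k)
  right : ∀ j → Side m k (m ↑ʳ j)

side : ∀ m {k} (u : Fin (m + k)) → Side m k u
side m {k} u with splitAt m {k} u in e
... | inj₁ i = subst (Side m k) (splitAt⁻¹-↑ˡ e) (left i)
... | inj₂ j = subst (Side m k) (splitAt⁻¹-↑ʳ e) (right j)

module _ {m k} (R : Rel m) (S : Rel k) where

  ⊕-ˡˡ : ∀ i j → (R ⊕ S) (i ↑ˡ k) (j ↑ˡ k) ≡ R i j
  ⊕-ˡˡ i j rewrite splitAt-↑ˡ m i k | splitAt-↑ˡ m j k = refl

  ⊕-ˡʳ : ∀ i j → (R ⊕ S) (i ↑ˡ k) (m ↑ʳ j) ≡ false
  ⊕-ˡʳ i j rewrite splitAt-↑ˡ m i k | splitAt-↑ʳ m k j = refl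

  ⊕-ʳˡ : ∀ i j → (R ⊕ S) (m ↑ʳ i) (j ↑ˡ k) ≡ false
  ⊕-ʳˡ i j rewrite splitAt-↑ʳ m k i | splitAt-↑ˡ m j k = refl

  ⊕-ʳʳ : ∀ i j → (R ⊕ S) (m ↑ʳ i) (m ↑ʳ j) ≡ S i j
  ⊕-ʳʳ i j rewrite splitAt-↑ʳ m k i | splitAt-↑ʳ m k j = refl

module _ (a b : ℕ) where

  K-ˡˡ : ∀ i j → K a b (i ↑ˡ b) (j ↑ˡ b) ≡ false
  K-ˡˡ i j rewrite splitAt-↑ˡ a i b | splitAt-↑ˡ a j b = refl

  K-ˡʳ : ∀ i j → K a b (i ↑ˡ b) (a ↑ʳ j) ≡ true
  K-ˡʳ i j rewrite splitAt-↑ˡ a i b | splitAt-↑ʳ a b j = refl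

  K-ʳˡ : ∀ i j → K a b (a ↑ʳ i) (j ↑ˡ b) ≡ true
  K-ʳˡ i j rewrite splitAt-↑ʳ a b i | splitAt-↑ˡ a j b = refl

  K-ʳʳ : ∀ i j → K a b (a ↑ʳ i) (a ↑ʳ j) ≡ false
  K-ʳʳ i j rewrite splitAt-↑ʳ a b i | splitAt-↑ʳ a b j = refl

arcs-blocks : ∀ {m k} (X : Rel (m + k)) → arcs X ≡
  (∑ (λ i → ∑ (λ j → [ X (i ↑ˡ k) (j ↑ˡ k) ])) + ∑ (λ i → ∑ (λ j → [ X (i ↑ˡ k) (m ↑ʳ j) ])))
  + (∑ (λ i → ∑ (λ j → [ X (m ↑ʳ i) (j ↑ˡ k) ])) + ∑ (λ i → ∑ (λ j → [ X (m ↑ʳ i) (m ↑ʳ j) ])))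
arcs-blocks {m} {k} X = trans (∑-↑ m k _) (cong₂ _+_ (split-rows (_↑ˡ k)) (split-rows (m ↑ʳ_)))
  where
  split-rows : ∀ {l} (f : Fin l → Fin (m + k)) →
    ∑ (λ i → ∑ (λ v → [ X (f i) v ])) ≡ ∑ (λ i → ∑ (λ j → [ X (f i) (j ↑ˡ k) ])) + ∑ (λ i → ∑ (λ j → [ X (f i) (m ↑ʳ j) ]))
  split-rows f = trans (∑-cong (λ i → ∑-↑ m k _)) (∑-distrib-+ _ _)

private
  ∑-zero² : ∀ {m k} {f : Fin m → Fin k → Bool} → (∀ i j → f i j ≡ false) → ∑ (λ i → ∑ (λ j → [ f i j ])) ≡ 0
  ∑-zero² f≡false = ∑-zero λ i → ∑-zero λ j → cong [_] (f≡false i j)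

  ∑-one² : ∀ {m k} {f : Fin m → Fin k → Bool} → (∀ i j → f i j ≡ true) → ∑ (λ i → ∑ (λ j → [ f i j ])) ≡ m * k
  ∑-one² {m} {k} f≡true = trans (∑-cong λ i → trans (∑-cong λ j → cong [_] (f≡true i j)) (∑-count k)) (∑-const m k)

arcs-⊕ : ∀ {m k} (R : Rel m) (S : Rel k) → arcs (R ⊕ S) ≡ arcs R + arcs S
arcs-⊕ R S = trans (arcs-blocks (R ⊕ S)) (cong₂ _+_
  (trans (cong₂ _+_ (arcs-cong (⊕-ˡˡ R S)) (∑-zero² (⊕-ˡʳ R S))) (+-identityʳ _))
  (cong₂ _+_ (∑-zero² (⊕-ʳˡ R S)) (arcs-cong (⊕-ʳʳ R S))))

arcs-K : ∀ a b → arcs (K a b) ≡ a * b + b * a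
arcs-K a b = trans (arcs-blocks (K a b)) (cong₂ _+_
  (cong₂ _+_ (∑-zero² (K-ˡˡ a b)) (∑-one² (K-ˡʳ a b)))
  (trans (cong₂ _+_ (∑-one² (K-ʳˡ a b)) (∑-zero² (K-ʳʳ a b))) (+-identityʳ _)))

arcs-≃ : ∀ {n m} {R : Rel n} {S : Rel m} → R ≃ S → arcs R ≡ arcs S
arcs-≃ {R = R} {S} (mk≃ σ hom) = ≡.sym (begin
  ∑ (λ x → ∑ (λ y → [ S x y ]))                        ≡⟨ ∑-permute _ σ ⟩
  ∑ (λ u → ∑ (λ y → [ S (to u) y ]))                   ≡⟨ ∑-cong (λ u → ∑-permute _ σ) ⟩
  ∑ (λ u → ∑ (λ v → [ S (to u) (to v) ]))              ≡⟨ arcs-cong (λ u v → hom u v) ⟨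
  arcs R                                                ∎)
  where
  open ≡-Reasoning
  to = Inverse.to σ

==-injective : ∀ {a b} (f : Fin a → Fin b) → (∀ u v → f u ≡ f v → u ≡ v) → ∀ u v → (f u == f v) ≡ (u == v)
==-injective f inj u v = bool-ext
  (λ e → subst (λ w → (u == w) ≡ true) (inj u v (==⇒≡ (f u) (f v) e)) (==-refl u))
  (λ e → subst (λ w → (f u == f w) ≡ true) (==⇒≡ u v e) (==-refl (f u)))

-- f embeds X into Y as a union of connected components of Y.
square-embedding : ∀ {a b} (X : Rel a) (Y : Rel b) (f : Fin a → Fin b) → (∀ u v → f u ≡ f v → u ≡ v) →
  (∀ u w → X u w ≡ Y (f u) (f w)) → (∀ u y → Y (f u) y ≡ true → ∃ λ w → f w ≡ y) →
  ∀ u v → square X u v ≡ square Y (f u) (f v)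
square-embedding X Y f inj hom closed u v = bool-ext forth back
  where
  forth : square X u v ≡ true → square Y (f u) (f v) ≡ true
  forth e with squareWithin-elim X everything u v e
  ... | u≠v , w , _ , uw , vw = square-intro Y (f u) (f v) (f w)
    (trans (==-injective f inj u v) u≠v) (trans (≡.sym (hom u w)) uw) (trans (≡.sym (hom v w)) vw)
  back : square Y (f u) (f v) ≡ true → square X u v ≡ true
  back e with squareWithin-elim Y everything (f u) (f v) e
  ... | fu≠fv , y , _ , uy , vy with closed u y uy
  ...   | w , refl = square-intro X u v w
    (trans (≡.sym (==-injective f inj u v)) fu≠fv) (trans (hom u w) uy) (trans (hom v w) vy)

square-≃ : ∀ {n m} {R : Rel n} {S : Rel m} → R ≃ S → square R ≃ square S
square-≃ {R = R} {S} (mk≃ σ hom) = mk≃ σ (square-embedding R S (Inverse.to σ) injective hom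
  λ _ y _ → Inverse.from σ y , Inverse.strictlyInverseˡ σ y)
  where
  injective : ∀ u v → Inverse.to σ u ≡ Inverse.to σ v → u ≡ v
  injective u v e = trans (≡.sym (Inverse.strictlyInverseʳ σ u))
                          (trans (cong (Inverse.from σ) e) (Inverse.strictlyInverseʳ σ v))

square-disjoint : ∀ {n} (X : Rel n) u v → (∀ w → X u w ≡ true → X v w ≡ false) → square X u v ≡ false
square-disjoint X u v disjoint with square X u v in e
... | false = refl
... | true with squareWithin-elim X everything u v e
...   | _ , w , _ , uw , vw = ⊥-elim (not-both vw (disjoint w uw))

square-common : ∀ {n} (X : Rel n) u v w → X u w ≡ true → X v w ≡ true → square X u v ≡ not (u == v)
square-common X u v w uw vw = bool-ext
  (λ e → cong not (proj₁ (squareWithin-elim X everything u v e)))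
  (λ e → square-intro X u v w (not-true e) uw vw)

module _ {m k} (R : Rel m) (S : Rel k) where

  private
    closedˡ : ∀ u y → (R ⊕ S) (u ↑ˡ k) y ≡ true → ∃ λ w → w ↑ˡ k ≡ y
    closedˡ u y uy with side m y
    ... | left w  = w , refl
    ... | right w = ⊥-elim (not-both uy (⊕-ˡʳ R S u w))

    closedʳ : ∀ u y → (R ⊕ S) (m ↑ʳ u) y ≡ true → ∃ λ w → m ↑ʳ w ≡ y
    closedʳ u y uy with side m y
    ... | left w  = ⊥-elim (not-both uy (⊕-ʳˡ R S u w))
    ... | right w = w , refl

    square-⊕-ˡʳ : ∀ i j → square (R ⊕ S) (i ↑ˡ k) (m ↑ʳ j) ≡ false
    square-⊕-ˡʳ i j = square-disjoint (R ⊕ S) _ _ λ w iw → separate (side m w) iw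
      where
      separate : ∀ {w} → Side m k w → (R ⊕ S) (i ↑ˡ k) w ≡ true → (R ⊕ S) (m ↑ʳ j) w ≡ false
      separate (left w)  _  = ⊕-ʳˡ R S j w
      separate (right w) iw = ⊥-elim (not-both iw (⊕-ˡʳ R S i w))

  square-⊕ : ∀ u v → square (R ⊕ S) u v ≡ (square R ⊕ square S) u v
  square-⊕ u v with side m u | side m v
  ... | left i  | left j  = trans (≡.sym (square-embedding R (R ⊕ S) (_↑ˡ k) (↑ˡ-injective k) (λ u w → ≡.sym (⊕-ˡˡ R S u w)) closedˡ i j))
                                  (≡.sym (⊕-ˡˡ (square R) (square S) i j))
  ... | left i  | right j = trans (square-⊕-ˡʳ i j) (≡.sym (⊕-ˡʳ (square R) (square S) i j))
  ... | right i | left j  = trans (square-sym (R ⊕ S) (m ↑ʳ i) (j ↑ˡ k)) (trans (square-⊕-ˡʳ j i) (≡.sym (⊕-ʳˡ (square R) (square S) i j)))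
  ... | right i | right j = trans (≡.sym (square-embedding S (R ⊕ S) (m ↑ʳ_) (↑ʳ-injective m) (λ u w → ≡.sym (⊕-ʳʳ R S u w)) closedʳ i j))
                                  (≡.sym (⊕-ʳʳ (square R) (square S) i j))

complete : ∀ n → Rel n
complete n i j = not (i == j)

arcs-complete : ∀ a → arcs (complete a) + a ≡ a * a
arcs-complete a = begin
  arcs (complete a) + a                          ≡⟨ cong (arcs (complete a) +_) (∑-count a) ⟨
  arcs (complete a) + ∑ (λ _ → 1)                ≡⟨ ∑-distrib-+ _ _ ⟨
  ∑ (λ i → ∑ (λ j → [ not (i == j) ]) + 1)       ≡⟨ ∑-cong row ⟩
  ∑ (λ _ → a)                                    ≡⟨ ∑-const a a ⟩
  a * a                                          ∎
  where
  open ≡-Reasoning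
  row : ∀ i → ∑ (λ j → [ not (i == j) ]) + 1 ≡ a
  row i = ≡.sym (trans (≡.sym (∑-count a)) (trans (∑-remove everything i)
                  (cong (_+ 1) (∑-cong λ j → cong (λ b → [ not b ]) (==-sym j i)))))

private
  square-K-cross : ∀ a b i j → square (K a b) (i ↑ˡ b) (a ↑ʳ j) ≡ false
  square-K-cross a b i j = square-disjoint (K a b) _ _ λ w iw → separate (side a w) iw
    where
    separate : ∀ {w} → Side a b w → K a b (i ↑ˡ b) w ≡ true → K a b (a ↑ʳ j) w ≡ false
    separate (left w)  iw = ⊥-elim (not-both iw (K-ˡˡ a b i w))
    separate (right w) _  = K-ʳʳ a b j w

-- Two vertices on the same side of K a b are joined in the square through any vertex of the other side.
square-K : ∀ a b → 1 ≤ a → 1 ≤ b → ∀ u v → square (K a b) u v ≡ (complete a ⊕ complete b) u v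
square-K a@(suc _) b@(suc _) _ _ u v with side a u | side a v
... | left i  | left j  =
  trans (square-common (K a b) (i ↑ˡ b) (j ↑ˡ b) (a ↑ʳ zero) (K-ˡʳ a b i zero) (K-ˡʳ a b j zero))
        (trans (cong not (==-injective (_↑ˡ b) (↑ˡ-injective b) i j)) (≡.sym (⊕-ˡˡ (complete a) (complete b) i j)))
... | left i  | right j = trans (square-K-cross a b i j) (≡.sym (⊕-ˡʳ (complete a) (complete b) i j))
... | right i | left j  =
  trans (square-sym (K a b) (a ↑ʳ i) (j ↑ˡ b)) (trans (square-K-cross a b j i) (≡.sym (⊕-ʳˡ (complete a) (complete b) i j)))
... | right i | right j =
  trans (square-common (K a b) (a ↑ʳ i) (a ↑ʳ j) (zero ↑ˡ b) (K-ʳˡ a b i zero) (K-ʳˡ a b j zero))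
        (trans (cong not (==-injective (a ↑ʳ_) (↑ʳ-injective a) i j)) (≡.sym (⊕-ʳʳ (complete a) (complete b) i j)))

arcs-square-K : ∀ a b → 1 ≤ a → 1 ≤ b → arcs (square (K a b)) + a + b ≡ a * a + b * b
arcs-square-K a b 1≤a 1≤b = begin
  arcs (square (K a b)) + a + b                     ≡⟨ cong (λ x → x + a + b) (trans (arcs-cong (square-K a b 1≤a 1≤b)) (arcs-⊕ _ _)) ⟩
  arcs (complete a) + arcs (complete b) + a + b     ≡⟨ regroup (arcs (complete a)) (arcs (complete b)) a b ⟩
  (arcs (complete a) + a) + (arcs (complete b) + b) ≡⟨ cong₂ _+_ (arcs-complete a) (arcs-complete b) ⟩
  a * a + b * b                                     ∎
  where
  open ≡-Reasoning
  regroup : ∀ x y a b → x + y + a + b ≡ (x + a) + (y + b)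
  regroup = solve-∀

count : ∀ {n} → VertexSet n → ℕ
count {zero}  P = 0
count {suc n} P = [ P zero ] + count (P ∘ suc)

count-complement : ∀ {n} (P : VertexSet n) → count P + count (not ∘ P) ≡ n
count-complement {zero}  P = refl
count-complement {suc n} P = add (P zero) (count-complement (P ∘ suc))
  where
  add : ∀ b {x y} → x + y ≡ n → [ b ] + x + ([ not b ] + y) ≡ suc n
  add true          e = cong suc e
  add false {x} {y} e = trans (+-suc x y) (cong suc e)

count-positive : ∀ {n} (P : VertexSet n) x → P x ≡ true → 1 ≤ count P
count-positive {suc n} P zero    px rewrite px = s≤s z≤n
count-positive {suc n} P (suc x) px = ≤-trans (count-positive (P ∘ suc) x px) (m≤n+m _ [ P zero ])

-- Fin n splits into the vertices satisfying P (listed first, in order) and the others.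
private
  place : ∀ b {a c} → Fin ([ b ] + a) ⊎ Fin ([ not b ] + c)
  place true  = inj₁ zero
  place false = inj₂ zero

  shift : ∀ b {a c} → Fin a ⊎ Fin c → Fin ([ b ] + a) ⊎ Fin ([ not b ] + c)
  shift true  = Sum.map suc id
  shift false = Sum.map id suc

  divide-step : ∀ b {a c n} → (Fin n → Fin a ⊎ Fin c) → Fin (suc n) → Fin ([ b ] + a) ⊎ Fin ([ not b ] + c)
  divide-step b f zero    = place b
  divide-step b f (suc i) = shift b (f i)

  gather-step : ∀ b {a c n} → (Fin a ⊎ Fin c → Fin n) → Fin ([ b ] + a) ⊎ Fin ([ not b ] + c) → Fin (suc n)
  gather-step true  g (inj₁ zero)    = zero
  gather-step true  g (inj₁ (suc x)) = suc (g (inj₁ x))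
  gather-step true  g (inj₂ y)       = suc (g (inj₂ y))
  gather-step false g (inj₁ x)       = suc (g (inj₁ x))
  gather-step false g (inj₂ zero)    = zero
  gather-step false g (inj₂ (suc y)) = suc (g (inj₂ y))

  gather∘divide-step : ∀ b {a c n} (f : Fin n → Fin a ⊎ Fin c) g → (∀ i → g (f i) ≡ i) →
                       ∀ i → gather-step b g (divide-step b f i) ≡ i
  gather∘divide-step true  f g inv zero = refl
  gather∘divide-step false f g inv zero = refl
  gather∘divide-step b     f g inv (suc i) with f i | inv i
  gather∘divide-step true  f g inv (suc i) | inj₁ _ | e = cong suc e
  gather∘divide-step true  f g inv (suc i) | inj₂ _ | e = cong suc e
  gather∘divide-step false f g inv (suc i) | inj₁ _ | e = cong suc e
  gather∘divide-step false f g inv (suc i) | inj₂ _ | e = cong suc e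

  divide∘gather-step : ∀ b {a c n} (f : Fin n → Fin a ⊎ Fin c) g → (∀ x → f (g x) ≡ x) →
                       ∀ x → divide-step b f (gather-step b g x) ≡ x
  divide∘gather-step true  f g inv (inj₁ zero)    = refl
  divide∘gather-step true  f g inv (inj₁ (suc x)) = cong (Sum.map suc id) (inv (inj₁ x))
  divide∘gather-step true  f g inv (inj₂ y)       = cong (Sum.map suc id) (inv (inj₂ y))
  divide∘gather-step false f g inv (inj₁ x)       = cong (Sum.map id suc) (inv (inj₁ x))
  divide∘gather-step false f g inv (inj₂ zero)    = refl
  divide∘gather-step false f g inv (inj₂ (suc y)) = cong (Sum.map id suc) (inv (inj₂ y))

divide : ∀ {n} (P : VertexSet n) → Fin n → Fin (count P) ⊎ Fin (count (not ∘ P))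
divide {suc n} P = divide-step (P zero) (divide (P ∘ suc))

gather : ∀ {n} (P : VertexSet n) → Fin (count P) ⊎ Fin (count (not ∘ P)) → Fin n
gather {zero}  P (inj₁ ())
gather {zero}  P (inj₂ ())
gather {suc n} P = gather-step (P zero) (gather (P ∘ suc))

gather∘divide : ∀ {n} (P : VertexSet n) i → gather P (divide P i) ≡ i
gather∘divide {suc n} P = gather∘divide-step (P zero) _ _ (gather∘divide (P ∘ suc))

divide∘gather : ∀ {n} (P : VertexSet n) x → divide P (gather P x) ≡ x
divide∘gather {zero}  P (inj₁ ())
divide∘gather {zero}  P (inj₂ ())
divide∘gather {suc n} P = divide∘gather-step (P zero) _ _ (divide∘gather (P ∘ suc))

isLeft-divide : ∀ {n} (P : VertexSet n) i → isLeft (divide P i) ≡ P i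
isLeft-divide {suc n} P zero    = isLeft-place (P zero)
  where
  isLeft-place : ∀ b {a c} → isLeft (place b {a} {c}) ≡ b
  isLeft-place true  = refl
  isLeft-place false = refl
isLeft-divide {suc n} P (suc i) = trans (isLeft-shift (P zero) (divide (P ∘ suc) i)) (isLeft-divide (P ∘ suc) i)
  where
  isLeft-shift : ∀ b {a c} (x : Fin a ⊎ Fin c) → isLeft (shift b x) ≡ isLeft x
  isLeft-shift true  (inj₁ _) = refl
  isLeft-shift true  (inj₂ _) = refl
  isLeft-shift false (inj₁ _) = refl
  isLeft-shift false (inj₂ _) = refl

P-gather : ∀ {n} (P : VertexSet n) x → P (gather P x) ≡ isLeft x
P-gather P x = trans (≡.sym (isLeft-divide P (gather P x))) (cong isLeft (divide∘gather P x))

partition : ∀ {n} (P : VertexSet n) → Fin n ↔ (Fin (count P) ⊎ Fin (count (not ∘ P)))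
partition P = mk↔ₛ′ (divide P) (gather P) (divide∘gather P) (gather∘divide P)

inside outside : ∀ {n} → Rel n → (P : VertexSet n) → Rel _
inside  R P i j = R (gather P (inj₁ i)) (gather P (inj₁ j))
outside R P i j = R (gather P (inj₂ i)) (gather P (inj₂ j))

≃-K : ∀ {n} (R : Rel n) (P : VertexSet n) → (∀ u v → R u v ≡ (P u xor P v)) → R ≃ K (count P) (count (not ∘ P))
≃-K R P bipartite = ≃-trans R≃sides (≃-sym K≃sides)
  where
  sides : Fin (count P) ⊎ Fin (count (not ∘ P)) → Fin (count P) ⊎ Fin (count (not ∘ P)) → Bool
  sides x y = isLeft x xor isLeft y
  R≃sides : R ≃ sides
  R≃sides = mk≃ (partition P) λ u v →
    trans (bipartite u v) (≡.sym (cong₂ _xor_ (isLeft-divide P u) (isLeft-divide P v)))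
  K≃sides : K (count P) (count (not ∘ P)) ≃ sides
  K≃sides = mk≃ +↔⊎ λ _ _ → refl

≃-⊕ : ∀ {n} (R : Rel n) (P : VertexSet n) → (∀ u v → R u v ≡ true → P u ≡ P v) → R ≃ (inside R P ⊕ outside R P)
≃-⊕ R P closed = ≃-trans (mk≃ (partition P) hom) (≃-trans (≃-pointwise blocks) (≃-sym (⊕≃⊎ᴿ _ _)))
  where
  hom : ∀ u v → R u v ≡ R (gather P (divide P u)) (gather P (divide P v))
  hom u v = ≡.sym (cong₂ R (gather∘divide P u) (gather∘divide P v))
  no-edge : ∀ x y → isLeft x ≢ isLeft y → R (gather P x) (gather P y) ≡ false
  no-edge x y differ with R (gather P x) (gather P y) in e
  ... | false = refl
  ... | true  = ⊥-elim (differ (trans (≡.sym (P-gather P x)) (trans (closed _ _ e) (P-gather P y))))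
  blocks : ∀ x y → R (gather P x) (gather P y) ≡ (inside R P ⊎ᴿ outside R P) x y
  blocks (inj₁ _) (inj₁ _) = refl
  blocks (inj₁ x) (inj₂ y) = no-edge (inj₁ x) (inj₂ y) λ ()
  blocks (inj₂ x) (inj₁ y) = no-edge (inj₂ x) (inj₁ y) λ ()
  blocks (inj₂ _) (inj₂ _) = refl

-- Components of square-closed graphs

K-comm : ∀ a b → K a b ≃ K b a
K-comm a b = ≃-trans (K≃sides a b) (≃-trans (mk≃ (⊎-comm _ _) swap-sides) (≃-sym (K≃sides b a)))
  where
  sides : ∀ {A B : Set} → A ⊎ B → A ⊎ B → Bool
  sides x y = isLeft x xor isLeft y
  K≃sides : ∀ a b → K a b ≃ sides {Fin a} {Fin b}
  K≃sides a b = mk≃ +↔⊎ λ _ _ → refl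
  isLeft-swap : ∀ {A B : Set} (x : A ⊎ B) → isLeft (Sum.swap x) ≡ not (isLeft x)
  isLeft-swap (inj₁ _) = refl
  isLeft-swap (inj₂ _) = refl
  swap-sides : ∀ x y → sides {Fin a} {Fin b} x y ≡ sides (Sum.swap x) (Sum.swap y)
  swap-sides x y = ≡.sym (trans (cong₂ _xor_ (isLeft-swap x) (isLeft-swap y)) (xor-annihilates-not (isLeft x) (isLeft y)))

SquareClosed : ∀ {n} → Rel n → Set
SquareClosed R = ∀ u v x → R u v ≡ true → square R u x ≡ true → R v x ≡ true

record Splitting {n} (G : SimpleGraph n) : Set where
  field
    a b c   : ℕ
    rest    : SimpleGraph c
    splits  : adj G ≃ (K a b ⊕ adj rest)
    1≤a     : 1 ≤ a
    a≤b     : a ≤ b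
    order   : a + b + c ≡ n

-- In a square-closed graph the component of an edge u₀v₀ is N(u₀) ∪ N(v₀), and it is complete
-- bipartite with sides N(v₀) ∋ u₀ and N(u₀) ∋ v₀.
module Component {n} (G : SimpleGraph n) (closed : SquareClosed (adj G)) (u₀ v₀ : Fin n) (u₀v₀ : adj G u₀ v₀ ≡ true) where

  private
    R = adj G
    R-sym = SimpleGraph.sym G

    adj⇒≠ : ∀ {x y} → R x y ≡ true → (x == y) ≡ false
    adj⇒≠ {x} {y} xy = ≢⇒==false x y λ x≡y → not-both xy (trans (cong (R x) (≡.sym x≡y)) (irref G x))

    through : ∀ {x y} w → R x w ≡ true → R y w ≡ true → (y == x) ≡ false → square R x y ≡ true
    through {x} {y} w xw yw y≠x = square-intro R x y w (trans (==-sym x y) y≠x) xw yw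

    v₀u₀ : R v₀ u₀ ≡ true
    v₀u₀ = trans (R-sym v₀ u₀) u₀v₀

  across-v₀ : ∀ x y → R v₀ x ≡ true → R x y ≡ true → R u₀ y ≡ true
  across-v₀ x y v₀x xy with y == v₀ in y=v₀
  ... | true  = trans (cong (R u₀) (==⇒≡ y v₀ y=v₀)) u₀v₀
  ... | false = closed v₀ u₀ y v₀u₀ (through x v₀x (trans (R-sym y x) xy) y=v₀)

  across-u₀ : ∀ x y → R u₀ x ≡ true → R x y ≡ true → R v₀ y ≡ true
  across-u₀ x y u₀x xy with y == u₀ in y=u₀
  ... | true  = trans (cong (R v₀) (==⇒≡ y u₀ y=u₀)) v₀u₀
  ... | false = closed u₀ v₀ y u₀v₀ (through x u₀x (trans (R-sym y x) xy) y=u₀)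

  between : ∀ x y → R v₀ x ≡ true → R u₀ y ≡ true → R x y ≡ true
  between x y v₀x u₀y with x == u₀ in x=u₀
  ... | true  = trans (cong (λ z → R z y) (==⇒≡ x u₀ x=u₀)) u₀y
  ... | false = trans (R-sym x y) (closed u₀ y x u₀y (through v₀ u₀v₀ (trans (R-sym x v₀) v₀x) x=u₀))

  no-triangle : ∀ x → R v₀ x ≡ true → R u₀ x ≡ true → ⊥
  no-triangle x v₀x u₀x = not-both (closed u₀ v₀ v₀ u₀v₀ (through x u₀x v₀x (trans (==-sym v₀ u₀) (adj⇒≠ u₀v₀))))
                                   (irref G v₀)

  P : VertexSet n
  P x = R u₀ x ∨ R v₀ x

  P-closed : ∀ x y → R x y ≡ true → P x ≡ P y
  P-closed x y xy = bool-ext (step x y xy) (step y x (trans (R-sym y x) xy))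
    where
    step : ∀ x y → R x y ≡ true → P x ≡ true → P y ≡ true
    step x y xy px with R u₀ x in u₀x | R v₀ x in v₀x
    ... | true  | _    rewrite across-u₀ x y u₀x xy = ∨-zeroʳ (R u₀ y)
    ... | false | true rewrite across-v₀ x y v₀x xy = refl

  on-u₀-side : ∀ x → P x ≡ true → R v₀ x ≡ false → R u₀ x ≡ true
  on-u₀-side x px v₀x with R u₀ x
  ... | true  = refl
  ... | false = ⊥-elim (not-both px v₀x)

  P-bipartite : ∀ x y → P x ≡ true → P y ≡ true → R x y ≡ (R v₀ x xor R v₀ y)
  P-bipartite x y px py = sides (on-u₀-side x px) (on-u₀-side y py)
    where
    sides : (R v₀ x ≡ false → R u₀ x ≡ true) → (R v₀ y ≡ false → R u₀ y ≡ true) → R x y ≡ (R v₀ x xor R v₀ y)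
    sides u₀x u₀y with R v₀ x in v₀x | R v₀ y in v₀y
    ... | true  | true  with R x y in xy
    ...   | true  = ⊥-elim (no-triangle y v₀y (across-v₀ x y v₀x xy))
    ...   | false = refl
    sides u₀x u₀y | true  | false = between x y v₀x (u₀y refl)
    sides u₀x u₀y | false | true  = trans (R-sym x y) (between y x v₀y (u₀x refl))
    sides u₀x u₀y | false | false with R x y in xy
    ...   | true  = ⊥-elim (not-both (across-u₀ x y (u₀x refl) xy) v₀y)
    ...   | false = refl

  Q : VertexSet (count P)
  Q i = R v₀ (gather P (inj₁ i))

  P-gatherˡ : ∀ i → P (gather P (inj₁ i)) ≡ true
  P-gatherˡ i = P-gather P (inj₁ i)

  gather-onto : ∀ x → P x ≡ true → ∃ λ i → gather P (inj₁ i) ≡ x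
  gather-onto x px with divide P x in e
  ... | inj₁ i = i , trans (cong (gather P) (≡.sym e)) (gather∘divide P x)
  ... | inj₂ _ = ⊥-elim (not-both px (trans (≡.sym (isLeft-divide P x)) (cong isLeft e)))

  1≤count-Q : 1 ≤ count Q
  1≤count-Q with gather-onto u₀ (∨-zeroʳ′ v₀u₀)
    where
    ∨-zeroʳ′ : R v₀ u₀ ≡ true → P u₀ ≡ true
    ∨-zeroʳ′ e rewrite e = ∨-zeroʳ (R u₀ u₀)
  ... | i , e = count-positive Q i (trans (cong (R v₀) e) v₀u₀)

  1≤count-¬Q : 1 ≤ count (not ∘ Q)
  1≤count-¬Q with gather-onto v₀ (cong (_∨ R v₀ v₀) u₀v₀)
  ... | i , e = count-positive (not ∘ Q) i (cong not (trans (cong (R v₀) e) (irref G v₀)))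

  rest : SimpleGraph (count (not ∘ P))
  rest = record { adj = outside R P ; sym = λ _ _ → R-sym _ _ ; irref = λ _ → irref G _ }

  component : inside R P ≃ K (count Q) (count (not ∘ Q))
  component = ≃-K (inside R P) Q λ i j → P-bipartite _ _ (P-gatherˡ i) (P-gatherˡ j)

  splitting : Splitting G
  splitting with ≤-total (count Q) (count (not ∘ Q))
  ... | inj₁ Q≤¬Q = record
    { a = count Q ; b = count (not ∘ Q) ; c = count (not ∘ P) ; rest = rest
    ; splits = ≃-trans (≃-⊕ R P P-closed) (⊕-cong component (≃-refl _))
    ; 1≤a = 1≤count-Q ; a≤b = Q≤¬Q ; order = order }
    where
    order : count Q + count (not ∘ Q) + count (not ∘ P) ≡ n
    order = trans (cong (_+ count (not ∘ P)) (count-complement Q)) (count-complement P)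
  ... | inj₂ ¬Q≤Q = record
    { a = count (not ∘ Q) ; b = count Q ; c = count (not ∘ P) ; rest = rest
    ; splits = ≃-trans (≃-⊕ R P P-closed) (⊕-cong (≃-trans component (K-comm (count Q) (count (not ∘ Q)))) (≃-refl _))
    ; 1≤a = 1≤count-¬Q ; a≤b = ¬Q≤Q ; order = order }
    where
    order : count (not ∘ Q) + count Q + count (not ∘ P) ≡ n
    order = trans (cong (_+ count (not ∘ P)) (trans (+-comm (count (not ∘ Q)) (count Q)) (count-complement Q))) (count-complement P)

split-component : ∀ {n} (G : SimpleGraph n) → SquareClosed (adj G) → ∀ u v → adj G u v ≡ true → Splitting G
split-component G closed u v uv = Component.splitting G closed u v uv

-- The equality case

⌊t+t+m/2⌋ : ∀ t m → ⌊ t + t + m /2⌋ ≡ t + ⌊ m /2⌋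
⌊t+t+m/2⌋ zero    m = refl
⌊t+t+m/2⌋ (suc t) m rewrite +-suc t t = cong suc (⌊t+t+m/2⌋ t m)

halves : ∀ c → ∃ λ r → r ≤ 1 × c ≡ ⌊ c /2⌋ + ⌊ c /2⌋ + r
halves zero          = 0 , z≤n , refl
halves (suc zero)    = 1 , ≤-refl , refl
halves (suc (suc c)) with halves c
... | r , r≤1 , c≡ = r , r≤1 , cong suc (trans (cong suc c≡) (≡.sym (cong (_+ r) (+-suc ⌊ c /2⌋ ⌊ c /2⌋))))

excess : ∀ d r t → r ≤ 1 → d ≡ d * d + 2 * ⌊ d + r /2⌋ + t → t ≡ 0 × (d ≡ 0 ⊎ (d ≡ 1 × r ≡ 0))
excess 0 0 t _ e = ≡.sym e , inj₁ refl
excess 0 1 t _ e = ≡.sym e , inj₁ refl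
excess 1 0 t _ e = ≡.sym (suc-injective e) , inj₂ (refl , refl)
excess 1 1 t _ e with suc-injective e
... | ()
excess d@(suc (suc e)) r t _ eq = ⊥-elim (m≢1+n+m d {suc e + e * d + 2 * ⌊ d + r /2⌋ + t} (trans eq (square-large e (2 * ⌊ d + r /2⌋) t)))
  where
  square-large : ∀ e k l → suc (suc e) * suc (suc e) + k + l ≡ suc ((suc e + e * suc (suc e) + k + l) + suc (suc e))
  square-large = solve-∀

-- x and y count the arcs of the rest and of its square, s those of the square of K_{a,a+d}.
split-arithmetic : ∀ a d c x y s →
  s + a + (a + d) ≡ a * a + (a + d) * (a + d) →
  a * (a + d) + (a + d) * a + x ≡ s + y + 2 * ⌊ a + (a + d) + c /2⌋ →
  x ≤ y + 2 * ⌊ c /2⌋ →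
  x ≡ y + 2 * ⌊ c /2⌋ × (d ≡ 0 ⊎ (d ≡ 1 × ⌊ c /2⌋ + ⌊ c /2⌋ ≡ c))
split-arithmetic a d c x y s square-K extremal bound with halves c | m≤n⇒∃[o]m+o≡n bound
... | r , r≤1 , c≡ | t , slack with excess d r t r≤1 d≡
  where
  q = ⌊ c /2⌋
  w = ⌊ d + r /2⌋
  K′ = s + a + a + a * a + a * a + a * d + a * d
  half-n : ⌊ a + (a + d) + c /2⌋ ≡ (a + q) + w
  half-n = trans (cong ⌊_/2⌋ (trans (cong (a + (a + d) +_) c≡) (regroup a d q r))) (⌊t+t+m/2⌋ (a + q) (d + r))
    where
    regroup : ∀ a d q r → a + (a + d) + (q + q + r) ≡ (a + q) + (a + q) + (d + r)
    regroup = solve-∀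
  d≡ : d ≡ d * d + 2 * w + t
  d≡ = +-cancelʳ-≡ x d (d * d + 2 * w + t) (+-cancelˡ-≡ K′ (d + x) (d * d + 2 * w + t + x) (begin
    K′ + (d + x)                                                   ≡⟨ expand₁ s a d x ⟩
    (s + a + (a + d)) + (a * (a + d) + (a + d) * a + x)            ≡⟨ cong₂ _+_ square-K (trans extremal (cong (λ h → s + y + 2 * h) half-n)) ⟩
    (a * a + (a + d) * (a + d)) + (s + y + 2 * ((a + q) + w))      ≡⟨ expand₂ s a d y q w ⟩
    K′ + (d * d + 2 * w + (y + 2 * q))                             ≡⟨ cong (λ z → K′ + (d * d + 2 * w + z)) slack ⟨
    K′ + (d * d + 2 * w + (x + t))                                 ≡⟨ cong (K′ +_) (regroup (d * d + 2 * w) x t) ⟩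
    K′ + (d * d + 2 * w + t + x)                                   ∎))
    where
    open ≡-Reasoning
    expand₁ : ∀ s a d x → s + a + a + a * a + a * a + a * d + a * d + (d + x) ≡ (s + a + (a + d)) + (a * (a + d) + (a + d) * a + x)
    expand₁ = solve-∀
    expand₂ : ∀ s a d y q w → (a * a + (a + d) * (a + d)) + (s + y + 2 * ((a + q) + w)) ≡
                              s + a + a + a * a + a * a + a * d + a * d + (d * d + 2 * w + (y + 2 * q))
    expand₂ = solve-∀
    regroup : ∀ e x t → e + (x + t) ≡ e + t + x
    regroup = solve-∀
... | refl , d≡0⊎1 = trans (≡.sym (+-identityʳ x)) slack , Sum.map₂ (map₂ even) d≡0⊎1
  where
  even : r ≡ 0 → ⌊ c /2⌋ + ⌊ c /2⌋ ≡ c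
  even refl = ≡.sym (trans c≡ (+-identityʳ _))

Extremal : ∀ {n} → Rel n → Set
Extremal {n} R = arcs R ≡ arcs (square R) + 2 * ⌊ n /2⌋

arcs-square-⊕ : ∀ {m k} (R : Rel m) (S : Rel k) → arcs (square (R ⊕ S)) ≡ arcs (square R) + arcs (square S)
arcs-square-⊕ R S = trans (arcs-cong (square-⊕ R S)) (arcs-⊕ (square R) (square S))

arcs-K⊕ : ∀ {n c} {R : Rel n} a b (S : Rel c) → R ≃ (K a b ⊕ S) → arcs R ≡ a * b + b * a + arcs S
arcs-K⊕ a b S R≃ = trans (arcs-≃ R≃) (trans (arcs-⊕ (K a b) S) (cong (_+ arcs S) (arcs-K a b)))

arcs-square-K⊕ : ∀ {n c} {R : Rel n} a b (S : Rel c) → R ≃ (K a b ⊕ S) →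
                 arcs (square R) ≡ arcs (square (K a b)) + arcs (square S)
arcs-square-K⊕ a b S R≃ = trans (arcs-≃ (square-≃ R≃)) (arcs-square-⊕ (K a b) S)

arcs-bound : ∀ {n} (G : SimpleGraph n) → arcs (adj G) ≤ arcs (square (adj G)) + 2 * ⌊ n /2⌋
arcs-bound G = Counting.arcs-bound (adj G) (SimpleGraph.sym G) (irref G)

split-extremal : ∀ {a b c} {R : Rel (a + b + c)} (G : SimpleGraph c) → R ≃ (K a b ⊕ adj G) → 1 ≤ a → a ≤ b →
                 Extremal R → Extremal (adj G) × (b ≡ a ⊎ (b ≡ suc a × ⌊ c /2⌋ + ⌊ c /2⌋ ≡ c))
split-extremal {a} {b} {c} {R} G R≃ 1≤a a≤b extremal with m≤n⇒∃[o]m+o≡n a≤b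
... | d , refl = map₂ (Sum.map (λ d≡0 → trans (cong (a +_) d≡0) (+-identityʳ a))
                                (map₁ λ d≡1 → trans (cong (a +_) d≡1) (+-comm a 1)))
  (split-arithmetic a d c (arcs (adj G)) (arcs (square (adj G))) (arcs (square (K a (a + d))))
    (arcs-square-K a (a + d) 1≤a (≤-trans 1≤a a≤b))
    (trans (≡.sym (arcs-K⊕ a (a + d) (adj G) R≃))
           (trans extremal (cong (_+ 2 * ⌊ a + (a + d) + c /2⌋) (arcs-square-K⊕ a (a + d) (adj G) R≃))))
    (arcs-bound G))

extremal-K⊕ : ∀ {N m} {R : Rel N} t (S : Rel m) → N ≡ t + t + m → R ≃ (K t t ⊕ S) → 1 ≤ t → Extremal R → Extremal S
extremal-K⊕ {m = m} {R} t S refl R≃ 1≤t extremal = +-cancelˡ-≡ (s + t + t) (arcs S) (arcs (square S) + 2 * ⌊ m /2⌋) (begin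
  s + t + t + arcs S                                          ≡⟨ cong (_+ arcs S) (arcs-square-K t t 1≤t 1≤t) ⟩
  t * t + t * t + arcs S                                      ≡⟨ arcs-K⊕ t t S R≃ ⟨
  arcs R                                                      ≡⟨ extremal ⟩
  arcs (square R) + 2 * ⌊ t + t + m /2⌋                       ≡⟨ cong₂ (λ x h → x + 2 * h) (arcs-square-K⊕ t t S R≃) (⌊t+t+m/2⌋ t m) ⟩
  s + arcs (square S) + 2 * (t + ⌊ m /2⌋)                     ≡⟨ regroup s (arcs (square S)) t ⌊ m /2⌋ ⟩
  s + t + t + (arcs (square S) + 2 * ⌊ m /2⌋)                 ∎)
  where
  open ≡-Reasoning
  s = arcs (square (K t t))
  regroup : ∀ s y t h → s + y + 2 * (t + h) ≡ s + t + t + (y + 2 * h)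
  regroup = solve-∀

extremalBlocks : ℕ → List ℕ → List (ℕ × ℕ)
extremalBlocks n ts = map (λ t → (t , t)) ts ++ ((⌊ n /2⌋ ∸ sum ts , (n ∸ ⌊ n /2⌋) ∸ sum ts) ∷ [])

Canonical : ∀ n → Rel n → Set
Canonical n R = Σ (List ℕ) λ ts → All (0 <_) ts × sum ts ≤ ⌊ n /2⌋ × R ≃ unionK (extremalBlocks n ts)

canonical-K⊕ : ∀ {N m} {R : Rel N} t (S : Rel m) → N ≡ t + t + m → R ≃ (K t t ⊕ S) → 1 ≤ t → Canonical m S → Canonical N R
canonical-K⊕ {m = m} {R} t S refl R≃ 1≤t (ts , positive , ∑ts≤h , S≃) =
  t ∷ ts , 1≤t ∷ positive , ∑≤half ,
  subst (λ p → R ≃ (K t t ⊕ unionK (map (λ t → (t , t)) ts ++ (p ∷ [])))) (≡.sym (cong₂ _,_ first second))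
        (≃-trans R≃ (⊕-congˡ (K t t) S≃))
  where
  h = ⌊ m /2⌋
  σ = sum ts
  half : ⌊ t + t + m /2⌋ ≡ t + h
  half = ⌊t+t+m/2⌋ t m
  ∑≤half : t + σ ≤ ⌊ t + t + m /2⌋
  ∑≤half = subst (t + σ ≤_) (≡.sym half) (+-monoʳ-≤ t ∑ts≤h)
  first : ⌊ t + t + m /2⌋ ∸ (t + σ) ≡ h ∸ σ
  first = trans (cong (_∸ (t + σ)) half) ([m+n]∸[m+o]≡n∸o t h σ)
  second : (t + t + m ∸ ⌊ t + t + m /2⌋) ∸ (t + σ) ≡ (m ∸ h) ∸ σ
  second = begin
    (t + t + m ∸ ⌊ t + t + m /2⌋) ∸ (t + σ)   ≡⟨ cong (λ z → (t + t + m ∸ z) ∸ (t + σ)) half ⟩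
    (t + t + m ∸ (t + h)) ∸ (t + σ)           ≡⟨ cong (λ z → (z ∸ (t + h)) ∸ (t + σ)) (+-assoc t t m) ⟩
    (t + (t + m) ∸ (t + h)) ∸ (t + σ)         ≡⟨ cong (_∸ (t + σ)) ([m+n]∸[m+o]≡n∸o t (t + m) h) ⟩
    (t + m ∸ h) ∸ (t + σ)                     ≡⟨ cong (_∸ (t + σ)) (+-∸-assoc t (⌊n/2⌋≤n m)) ⟩
    (t + (m ∸ h)) ∸ (t + σ)                   ≡⟨ [m+n]∸[m+o]≡n∸o t (m ∸ h) σ ⟩
    (m ∸ h) ∸ σ                               ∎
    where open ≡-Reasoning

canonical-edgeless : ∀ {n} (G : SimpleGraph n) → arcs (adj G) ≡ 0 → Extremal (adj G) → Canonical n (adj G)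
canonical-edgeless {zero}          G _       _        = [] , [] , z≤n , ≃-empty _ _
canonical-edgeless {suc zero}      G _       _        = [] , [] , z≤n , ≃-pointwise λ { zero zero → irref G zero }
canonical-edgeless {suc (suc n)}   G no-arcs extremal with m+n≡0⇒n≡0 (arcs (square (adj G))) (trans (≡.sym extremal) no-arcs)
... | ()

canonical-K⊕empty : ∀ a {R : Rel (a + suc a + 0)} (S : Rel 0) → R ≃ (K a (suc a) ⊕ S) → Canonical (a + suc a + 0) R
canonical-K⊕empty a {R} S R≃ = [] , [] , z≤n ,
  subst (λ p → R ≃ unionK (p ∷ [])) (≡.sym (cong₂ _,_ first second)) (≃-trans R≃ (⊕-congˡ (K a (suc a)) (≃-empty S _)))
  where
  half : ⌊ a + suc a + 0 /2⌋ ≡ a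
  half = trans (cong ⌊_/2⌋ (regroup a)) (trans (⌊t+t+m/2⌋ a 1) (+-identityʳ a))
    where
    regroup : ∀ a → a + suc a + 0 ≡ a + a + 1
    regroup = solve-∀
  first : ⌊ a + suc a + 0 /2⌋ ∸ 0 ≡ a
  first = half
  second : (a + suc a + 0 ∸ ⌊ a + suc a + 0 /2⌋) ∸ 0 ≡ suc a
  second = trans (cong (a + suc a + 0 ∸_) half) (trans (cong (_∸ a) (+-identityʳ _)) (m+n∸m≡n a (suc a)))

edge-or-edgeless : ∀ {n} (G : SimpleGraph n) → (∃ λ u → ∃ λ v → adj G u v ≡ true) ⊎ arcs (adj G) ≡ 0
edge-or-edgeless G with 0 <? arcs (adj G)
... | yes arcs>0 = let (u , v , _ , _ , uv) = Counting.an-edge (adj G) (SimpleGraph.sym G) (irref G) everything arcs>0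
                   in inj₁ (u , v , uv)
... | no  arcs≯0 = inj₂ (n≤0⇒n≡0 (≮⇒≥ arcs≯0))

extremal⇒square-closed : ∀ {n} (G : SimpleGraph n) → Extremal (adj G) → SquareClosed (adj G)
extremal⇒square-closed G = Counting.extremal⇒square-closed (adj G) (SimpleGraph.sym G) (irref G)

Recursion : ℕ → Set
Recursion n = ∀ {m} → m < n → (G : SimpleGraph m) → Extremal (adj G) → Canonical m (adj G)

-- The rest of an unbalanced component K_{a,a+1} is empty, or it has a balanced component K_{a′,a′}
-- (an unbalanced one would make the rest odd); that one is moved to the front.
canonical-unbalanced : ∀ a {c} {R : Rel (a + suc a + c)} (G₂ : SimpleGraph c) → R ≃ (K a (suc a) ⊕ adj G₂) → 1 ≤ a →
  Extremal R → Extremal (adj G₂) → ⌊ c /2⌋ + ⌊ c /2⌋ ≡ c → Recursion (a + suc a + c) → Canonical (a + suc a + c) R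
canonical-unbalanced a {c} G₂ R≃ 1≤a extremal extremal₂ even rec with edge-or-edgeless G₂
... | inj₂ no-arcs with c≡0
  where
  c≡0 : c ≡ 0
  c≡0 = trans (≡.sym even) (cong (λ h → h + h) (*-cancelˡ-≡ ⌊ c /2⌋ 0 2 (m+n≡0⇒n≡0 (arcs (square (adj G₂))) (trans (≡.sym extremal₂) no-arcs))))
...   | refl = canonical-K⊕empty a (adj G₂) R≃
canonical-unbalanced a {R = R} G₂ R≃ 1≤a extremal extremal₂ even rec | inj₁ (u , v , uv)
  with split-component G₂ (extremal⇒square-closed G₂ extremal₂) u v uv
... | record { a = a′ ; b = b′ ; c = c₃ ; rest = G₃ ; splits = R₂≃ ; 1≤a = 1≤a′ ; a≤b = a′≤b′ ; order = refl }
  with split-extremal G₃ R₂≃ 1≤a′ a′≤b′ extremal₂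
...   | _ , inj₂ (refl , even₃) = ⊥-elim (even≢odd ⌊ c /2⌋ (a′ + ⌊ c₃ /2⌋)
          (trans (cong (⌊ c /2⌋ +_) (+-identityʳ ⌊ c /2⌋)) (trans even (trans (cong (a′ + suc a′ +_) (≡.sym even₃)) (regroup a′ ⌊ c₃ /2⌋)))))
  where
  c = a′ + suc a′ + c₃
  regroup : ∀ a h → a + suc a + (h + h) ≡ suc (2 * (a + h))
  regroup = solve-∀
...   | _ , inj₁ refl = canonical-K⊕ a′ (adj G′) reorder R≃′ 1≤a′ (rec smaller G′ (extremal-K⊕ a′ (adj G′) reorder R≃′ 1≤a′ extremal))
  where
  G′ = Kᴳ a (suc a) ⊕ᴳ G₃
  R≃′ : R ≃ (K a′ a′ ⊕ adj G′)
  R≃′ = ≃-trans R≃ (≃-trans (⊕-congˡ (K a (suc a)) R₂≃) (⊕-swap (K a (suc a)) (K a′ a′) (adj G₃)))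
  reorder : a + suc a + (a′ + a′ + c₃) ≡ a′ + a′ + (a + suc a + c₃)
  reorder = regroup a a′ c₃
    where
    regroup : ∀ a a′ c₃ → a + suc a + (a′ + a′ + c₃) ≡ a′ + a′ + (a + suc a + c₃)
    regroup = solve-∀
  smaller : a + suc a + c₃ < a + suc a + (a′ + a′ + c₃)
  smaller = +-monoʳ-< (a + suc a) (m<n+m c₃ (≤-trans 1≤a′ (m≤m+n a′ a′)))

extremal⇒canonical : ∀ {n} (G : SimpleGraph n) → Extremal (adj G) → Canonical n (adj G)
extremal⇒canonical {n} = <-rec (λ n → (G : SimpleGraph n) → Extremal (adj G) → Canonical n (adj G)) step n
  where
  step : ∀ n → Recursion n → (G : SimpleGraph n) → Extremal (adj G) → Canonical n (adj G)
  step n rec G extremal with edge-or-edgeless G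
  ... | inj₂ no-arcs = canonical-edgeless G no-arcs extremal
  ... | inj₁ (u , v , uv) with split-component G (extremal⇒square-closed G extremal) u v uv
  ...   | record { a = a ; b = b ; c = c ; rest = G₂ ; splits = R≃ ; 1≤a = 1≤a ; a≤b = a≤b ; order = refl }
          with split-extremal G₂ R≃ 1≤a a≤b extremal
  ...     | extremal₂ , inj₁ refl =
              canonical-K⊕ a (adj G₂) refl R≃ 1≤a (rec (m<n+m c (≤-trans 1≤a (m≤m+n a a))) G₂ extremal₂)
  ...     | extremal₂ , inj₂ (refl , even) = canonical-unbalanced a G₂ R≃ 1≤a extremal extremal₂ even rec

firsts : List (ℕ × ℕ) → ℕ
firsts []             = 0
firsts ((a , _) ∷ ps) = a + firsts ps

NearlyBalanced : ℕ × ℕ → Set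
NearlyBalanced (a , b) = a ≡ 0 ⊎ (1 ≤ a × (b ≡ a ⊎ b ≡ suc a))

arcs-K-nearlyBalanced : ∀ a b → NearlyBalanced (a , b) → arcs (K a b) ≡ arcs (square (K a b)) + 2 * a
arcs-K-nearlyBalanced a b (inj₁ refl) = trans (arcs-K 0 b) (trans (*-zeroʳ b)
  (≡.sym (trans (+-identityʳ _) (∑-zero λ u → ∑-zero λ v → cong [_] (square-disjoint (K 0 b) u v λ _ ())))))
arcs-K-nearlyBalanced a b (inj₂ (1≤a , inj₁ refl)) = begin
  arcs (K a a)                         ≡⟨ arcs-K a a ⟩
  a * a + a * a                        ≡⟨ arcs-square-K a a 1≤a 1≤a ⟨
  arcs (square (K a a)) + a + a        ≡⟨ regroup (arcs (square (K a a))) a ⟩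
  arcs (square (K a a)) + 2 * a        ∎
  where
  open ≡-Reasoning
  regroup : ∀ s a → s + a + a ≡ s + 2 * a
  regroup = solve-∀
arcs-K-nearlyBalanced a b (inj₂ (1≤a , inj₂ refl)) = +-cancelʳ-≡ (a + suc a) _ _ (begin
  arcs (K a (suc a)) + (a + suc a)                    ≡⟨ cong (_+ (a + suc a)) (arcs-K a (suc a)) ⟩
  a * suc a + suc a * a + (a + suc a)                 ≡⟨ regroup₁ a ⟩
  a * a + suc a * suc a + 2 * a                       ≡⟨ cong (_+ 2 * a) (arcs-square-K a (suc a) 1≤a (s≤s z≤n)) ⟨
  s + a + suc a + 2 * a                               ≡⟨ regroup₂ s a ⟩
  s + 2 * a + (a + suc a)                             ∎)
  where
  open ≡-Reasoning
  s = arcs (square (K a (suc a)))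
  regroup₁ : ∀ a → a * suc a + suc a * a + (a + suc a) ≡ a * a + suc a * suc a + 2 * a
  regroup₁ = solve-∀
  regroup₂ : ∀ s a → s + a + suc a + 2 * a ≡ s + 2 * a + (a + suc a)
  regroup₂ = solve-∀

arcs-unionK : ∀ ps → All NearlyBalanced ps → arcs (unionK ps) ≡ arcs (square (unionK ps)) + 2 * firsts ps
arcs-unionK []             []       = trans (∑-zero λ ()) (≡.sym (trans (+-identityʳ _) (∑-zero λ ())))
arcs-unionK ((a , b) ∷ ps) (p ∷ ps′) = begin
  arcs (K a b ⊕ unionK ps)                                                   ≡⟨ arcs-⊕ (K a b) (unionK ps) ⟩
  arcs (K a b) + arcs (unionK ps)                                            ≡⟨ cong₂ _+_ (arcs-K-nearlyBalanced a b p) (arcs-unionK ps ps′) ⟩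
  (arcs (square (K a b)) + 2 * a) + (arcs (square (unionK ps)) + 2 * firsts ps) ≡⟨ regroup (arcs (square (K a b))) (arcs (square (unionK ps))) a (firsts ps) ⟩
  (arcs (square (K a b)) + arcs (square (unionK ps))) + 2 * (a + firsts ps)   ≡⟨ cong (_+ 2 * (a + firsts ps)) (arcs-square-⊕ (K a b) (unionK ps)) ⟨
  arcs (square (K a b ⊕ unionK ps)) + 2 * (a + firsts ps)                    ∎
  where
  open ≡-Reasoning
  regroup : ∀ x y a s → (x + 2 * a) + (y + 2 * s) ≡ (x + y) + 2 * (a + s)
  regroup = solve-∀

⌈n/2⌉-cases : ∀ n → n ∸ ⌊ n /2⌋ ≡ ⌊ n /2⌋ ⊎ n ∸ ⌊ n /2⌋ ≡ suc ⌊ n /2⌋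
⌈n/2⌉-cases zero          = inj₁ refl
⌈n/2⌉-cases (suc zero)    = inj₂ refl
⌈n/2⌉-cases (suc (suc n)) rewrite +-∸-assoc 1 (⌊n/2⌋≤n n) = Sum.map (cong suc) (cong suc) (⌈n/2⌉-cases n)

nearlyBalanced-last : ∀ n s → s ≤ ⌊ n /2⌋ → NearlyBalanced (⌊ n /2⌋ ∸ s , (n ∸ ⌊ n /2⌋) ∸ s)
nearlyBalanced-last n s s≤h =
  shape (⌊ n /2⌋ ∸ s) (Sum.map (cong (_∸ s)) (λ e → trans (cong (_∸ s) e) (+-∸-assoc 1 s≤h)) (⌈n/2⌉-cases n))
  where
  shape : ∀ a {b} → b ≡ a ⊎ b ≡ suc a → NearlyBalanced (a , b)
  shape zero    _  = inj₁ refl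
  shape (suc a) b≡ = inj₂ (s≤s z≤n , b≡)

extremalBlocks-nearlyBalanced : ∀ n ts → All (0 <_) ts → sum ts ≤ ⌊ n /2⌋ → All NearlyBalanced (extremalBlocks n ts)
extremalBlocks-nearlyBalanced n ts positive ∑≤h =
  Allₚ.++⁺ (Allₚ.map⁺ (All.map (λ t>0 → inj₂ (t>0 , inj₁ refl)) positive)) (nearlyBalanced-last n (sum ts) ∑≤h ∷ [])

firsts-diagonal : ∀ ts ps → firsts (map (λ t → (t , t)) ts ++ ps) ≡ sum ts + firsts ps
firsts-diagonal []       ps = refl
firsts-diagonal (t ∷ ts) ps = trans (cong (t +_) (firsts-diagonal ts ps)) (≡.sym (+-assoc t (sum ts) (firsts ps)))

firsts-extremalBlocks : ∀ n ts → sum ts ≤ ⌊ n /2⌋ → firsts (extremalBlocks n ts) ≡ ⌊ n /2⌋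
firsts-extremalBlocks n ts ∑≤h =
  trans (firsts-diagonal ts _) (trans (cong (sum ts +_) (+-identityʳ _)) (m+[n∸m]≡n ∑≤h))

canonical⇒extremal : ∀ {n} {R : Rel n} → Canonical n R → Extremal R
canonical⇒extremal {n} {R} (ts , positive , ∑≤h , R≃) = begin
  arcs R                                                   ≡⟨ arcs-≃ R≃ ⟩
  arcs U                                                   ≡⟨ arcs-unionK (extremalBlocks n ts) (extremalBlocks-nearlyBalanced n ts positive ∑≤h) ⟩
  arcs (square U) + 2 * firsts (extremalBlocks n ts)       ≡⟨ cong₂ (λ x h → x + 2 * h) (arcs-≃ (square-≃ R≃)) (≡.sym (firsts-extremalBlocks n ts ∑≤h)) ⟨
  arcs (square R) + 2 * ⌊ n /2⌋                            ∎
  where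
  open ≡-Reasoning
  U = unionK (extremalBlocks n ts)

/-2≡⌊/2⌋ : ∀ n → n / 2 ≡ ⌊ n /2⌋
/-2≡⌊/2⌋ zero          = refl
/-2≡⌊/2⌋ (suc zero)    = refl
/-2≡⌊/2⌋ (suc (suc n)) = trans (m/n≡1+[m∸n]/n {suc (suc n)} {2} (s≤s (s≤s z≤n))) (cong suc (/-2≡⌊/2⌋ n))

module _ {n} (G : SimpleGraph n) where

  private
    R = adj G
    2*edges≡arcs : 2 * edges R ≡ arcs R
    2*edges≡arcs = ≡.sym (arcs≡2*edges R (SimpleGraph.sym G) (irref G))
    2*edges≡arcs-square : 2 * edges (square R) ≡ arcs (square R)
    2*edges≡arcs-square = ≡.sym (arcs≡2*edges (square R) (square-sym R) (square-irrefl R))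
    double : 2 * (edges (square R) + ⌊ n /2⌋) ≡ arcs (square R) + 2 * ⌊ n /2⌋
    double = trans (*-distribˡ-+ 2 (edges (square R)) ⌊ n /2⌋) (cong (_+ 2 * ⌊ n /2⌋) 2*edges≡arcs-square)

  edges-bound : edges R ≤ edges (square R) + ⌊ n /2⌋
  edges-bound = *-cancelˡ-≤ 2 (subst₂ _≤_ (≡.sym 2*edges≡arcs) (≡.sym double) (arcs-bound G))

  extremal⇔edges : Extremal R ⇔ (edges R ≡ edges (square R) + ⌊ n /2⌋)
  extremal⇔edges = mk⇔
    (λ extremal → *-cancelˡ-≡ _ _ 2 (trans 2*edges≡arcs (trans extremal (≡.sym double))))
    (λ e → trans (≡.sym 2*edges≡arcs) (trans (cong (2 *_) e) double))

lemma5p3 : (n : ℕ) (G : SimpleGraph n) →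
    (edges (adj G) ≤ edges (square (adj G)) + n / 2)
    × ((edges (adj G) ≡ edges (square (adj G)) + n / 2)
       ⇔ Σ (List ℕ) λ ts → All (0 <_) ts × sum ts ≤ n / 2
           × (adj G ≅ unionK (map (λ t → (t , t)) ts
                 ++ ((n / 2 ∸ sum ts , (n ∸ n / 2) ∸ sum ts) ∷ []))))
lemma5p3 n G rewrite /-2≡⌊/2⌋ n = edges-bound G , mk⇔
  (λ e → let (ts , positive , ∑≤h , G≃) = extremal⇒canonical G (Equivalence.from (extremal⇔edges G) e)
         in ts , positive , ∑≤h , ≃⇒≅ G≃)
  (λ (ts , positive , ∑≤h , G≅) → Equivalence.to (extremal⇔edges G) (canonical⇒extremal (ts , positive , ∑≤h , ≅⇒≃ G≅)))
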